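{- Let $m,n$ be positive integers and let $F_{m,n}=E_m+P_n$ be the generalized fan graph. The double vertex graph $F_{m,n}^{\{2\}}$ is Hamiltonian if and only if either $n\geq 2$ and $1\leq m\leq 2n$, or $n=1$ and $m=3$.
   Context: All graphs are simple. For a graph $G$ of order $n$ and an integer $1\leq k\leq n-1$, the $k$-token graph $G^{\{k\}}$ is the graph whose vertices are the $k$-element subsets of $V(G)$, two such subsets being adjacent whenever their symmetric difference is a pair $\{u,v\}$ with $uv\in E(G)$. The $2$-token graph is called the double vertex graph. For disjoint graphs $G,H$, the join $G+H$ has vertex set $V(G)\cup V(H)$ and edge set $E(G)\cup E(H)\cup\{xy: x\in V(G), y\in V(H)\}$. $E_m$ denotes the edgeless graph on $m$ vertices and $P_n$ the path on $n$ vertices; $F_{m,n}=E_m+P_n$. A graph is Hamiltonian if it has a cycle through every vertex exactly once. -}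

module Defs where

open import Data.Nat using (ℕ; zero; suc; _+_; _≤_; _<_; _<?_; s≤s)
open import Data.Fin using (Fin; toℕ; fromℕ<; _↑ˡ_; _↑ʳ_)
open import Data.Fin.Subset using (Subset; ∣_∣; ⁅_⁆; _∪_; _∈_)
open import Data.Bool using (_xor_)
open import Data.Vec using (zipWith)
open import Data.Product using (Σ; ∃; _×_; _,_)
open import Data.Sum using (_⊎_)
open import Function.Definitions using (Bijective)
open import Relation.Binary.PropositionalEquality using (_≡_; _≢_)
open import Relation.Nullary using (¬_; yes; no)

record Graph (n : ℕ) : Set₁ where
  field
    Adj     : Fin n → Fin n → Set
    sym     : ∀ {u v} → Adj u v → Adj v u
    irrefl  : ∀ {u} → ¬ Adj u u
open Graph public using (Adj)

next : ∀ {K} → Fin K → Fin K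
next {suc K} i with suc (toℕ i) <? suc K
... | yes p = fromℕ< p
... | no _ = Fin.zero

Hamiltonian : (V : Set) → (V → V → Set) → Set
Hamiltonian V Adj =
  Σ ℕ λ K → (3 ≤ K) × (Σ (Fin K → V) λ f →
    Bijective _≡_ _≡_ f × (∀ i → Adj (f i) (f (next i))))

_Δ_ : ∀ {n} → Subset n → Subset n → Subset n
s Δ t = zipWith _xor_ s t

TokenVertex : ∀ {n} → Graph n → ℕ → Set
TokenVertex {n} G k = Σ (Subset n) λ A → ∣ A ∣ ≡ k

TokenAdj : ∀ {n} (G : Graph n) (k : ℕ) → TokenVertex G k → TokenVertex G k → Set
TokenAdj {n} G k (A , _) (B , _) =
  Σ (Fin n) λ u → Σ (Fin n) λ v → u ≢ v × Adj G u v × (A Δ B ≡ ⁅ u ⁆ ∪ ⁅ v ⁆)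

TokenHamiltonian : ∀ {n} → Graph n → ℕ → Set
TokenHamiltonian G k = Hamiltonian (TokenVertex G k) (TokenAdj G k)

-- Generalized fan F_{m,n} = E_m + P_n on Fin (m + n):
-- vertices i ↑ˡ n (i < m) form E_m; vertices m ↑ʳ j (j < n) form the path
-- P_n with j ~ j+1.
data FanAdj (m n : ℕ) : Fin (m + n) → Fin (m + n) → Set where
  join₁ : (i : Fin m) (j : Fin n) → FanAdj m n (i ↑ˡ n) (m ↑ʳ j)
  join₂ : (i : Fin m) (j : Fin n) → FanAdj m n (m ↑ʳ j) (i ↑ˡ n)
  path₁ : (i j : Fin n) → suc (toℕ i) ≡ toℕ j → FanAdj m n (m ↑ʳ i) (m ↑ʳ j)
  path₂ : (i j : Fin n) → suc (toℕ j) ≡ toℕ i → FanAdj m n (m ↑ʳ i) (m ↑ʳ j)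

private
  open import Data.Fin.Properties using (toℕ-↑ˡ; toℕ-↑ʳ; toℕ<n; toℕ-injective)
  open import Data.Nat.Properties using (<-irrefl; m≤m+n; ≤-trans; n<1+n; <⇒≢; +-cancelˡ-≡)
  open import Relation.Binary.PropositionalEquality using (refl; cong; trans; sym)

  fan-sym : ∀ {m n u v} → FanAdj m n u v → FanAdj m n v u
  fan-sym (join₁ i j) = join₂ i j
  fan-sym (join₂ i j) = join₁ i j
  fan-sym (path₁ i j e) = path₂ j i e
  fan-sym (path₂ i j e) = path₁ j i e

  lr : ∀ {m n} (i : Fin m) (j : Fin n) → (i ↑ˡ n) ≢ (m ↑ʳ j)
  lr {m} {n} i j e = <-irrefl refl (≤-trans lt (≤-trans (m≤m+n m (toℕ j)) (Data.Nat.Properties.≤-reflexive (sym e'))))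
    where
      e' : toℕ i ≡ m + toℕ j
      e' = trans (sym (toℕ-↑ˡ i n)) (trans (cong toℕ e) (toℕ-↑ʳ m j))
      lt : suc (toℕ i) ≤ m
      lt = toℕ<n i

  rr : ∀ {m n} (i j : Fin n) → suc (toℕ i) ≡ toℕ j → (m ↑ʳ i) ≢ (m ↑ʳ j)
  rr {m} i j s e = <⇒≢ (n<1+n (toℕ i)) (trans e'' (sym s))
    where
      e'' : toℕ i ≡ toℕ j
      e'' = +-cancelˡ-≡ m _ _ (trans (sym (toℕ-↑ʳ m i)) (trans (cong toℕ e) (toℕ-↑ʳ m j)))

  fan-≢ : ∀ {m n u v} → FanAdj m n u v → u ≢ v
  fan-≢ (join₁ i j) = lr i j
  fan-≢ (join₂ i j) e = lr i j (sym e)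
  fan-≢ (path₁ i j s) = rr i j s
  fan-≢ (path₂ i j s) e = rr j i s (sym e)

Fan : (m n : ℕ) → Graph (m + n)
Fan m n = record
  { Adj = FanAdj m n
  ; sym = fan-sym
  ; irrefl = λ a → fan-≢ a refl
  }

-- Write the 2-subsets of V(F_{m,n}) as tokens of kinds ee, ep and pp, according to how
-- many of their vertices lie on the path. The hubs e_i are pairwise non-adjacent, so in a
-- Hamiltonian cycle of F_{m,n}^{2} every ee-vertex is followed by an ep-vertex and no
-- pp-vertex is followed by an ee-vertex. For n ≥ 2 the cycle also leaves the pp-vertices
-- at least once, through an ep-vertex; hence C(m,2) + 1 ≤ mn, that is m ≤ 2n. For n = 1
-- there are no pp-vertices and every ep-vertex is followed by an ee-vertex, so C(m,2) = m,
-- that is m = 3.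
--
-- Conversely, for n ≥ 2 and m ≤ 2n the cycle visits the hubs in turn: hub i carries its
-- token along the path, detouring between consecutive path vertices to cover the ee- and
-- pp-vertices. Such itineraries are built by induction on n, either by lengthening the
-- path or, when m is too large for that, by adding two hubs at once.
module Submission where

open import Defs
open import Data.Nat
open import Data.Nat.Properties
open import Data.Nat.ListAction using (sum)
open import Data.Nat.ListAction.Properties using (sum-++; sum-↭)
open import Data.Nat.Tactic.RingSolver using (solve-∀)
open import Data.Bool using (true; false; _∨_; _xor_; T)
open import Data.Empty using (⊥-elim)
open import Data.Unit using (⊤; tt)
open import Data.Product using (Σ; _×_; _,_; proj₁; proj₂; ∃; ∃₂)
open import Data.Sum using (_⊎_; inj₁; inj₂; [_,_]′)
open import Data.Fin using (Fin; toℕ; fromℕ<; _↑ˡ_; _↑ʳ_)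
import Data.Fin as Fin
open import Data.Fin.Properties using (toℕ-fromℕ<; toℕ-injective; toℕ<n; toℕ-↑ˡ; toℕ-↑ʳ; toℕ-inject₁; toℕ-fromℕ)
open import Data.Fin.Subset using (Subset; ⊥; ⁅_⁆; _∪_; ∣_∣)
open import Data.Fin.Subset.Properties using (∪-identityˡ; ∪-comm)
open import Data.Vec using (Vec; []; _∷_; lookup)
open import Data.Vec.Properties using (lookup-replicate; lookup-zipWith; tabulate∘lookup; tabulate-cong)
open import Data.List using (List; []; _∷_; _++_; map; concatMap; length; [_]; replicate)
import Data.List as List
open import Data.List.Properties using (++-assoc; ++-identityʳ; length-++; length-map; length-replicate; map-++; concatMap-++)
open import Data.List.Membership.Propositional using (_∈_)
open import Data.List.Membership.Propositional.Properties using (∈-map⁺; ∈-map⁻; ∈-++⁺ˡ; ∈-++⁺ʳ; ∈-++⁻; ∈-lookup; ∈-tabulate⁺; ∈-tabulate⁻; ∈-length)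
open import Data.List.Membership.Propositional.Properties.WithK using (unique∧set⇒bag)
open import Data.List.Relation.Unary.All using (All; []; _∷_)
import Data.List.Relation.Unary.All as All
open import Data.List.Relation.Unary.All.Properties using (∷ʳ⁺; map⁺; replicate⁺) renaming (++⁺ to All-++⁺)
open import Data.List.Relation.Unary.Any using (here; there)
import Data.List.Relation.Unary.Any as Any
open import Data.List.Relation.Unary.Any.Properties using (lookup-index)
open import Data.List.Relation.Unary.AllPairs using ([]; _∷_)
open import Data.List.Relation.Unary.Unique.Propositional using (Unique)
import Data.List.Relation.Unary.Unique.Propositional.Properties as Unique
open import Data.List.Relation.Binary.Permutation.Propositional using (_↭_; ↭-refl; ↭-trans; ↭-sym; ↭-reflexive; prep; swap; ↭⇒↭ₛ; module PermutationReasoning)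
import Data.List.Relation.Binary.Permutation.Propositional as ↭
open import Data.List.Relation.Binary.Permutation.Propositional.Properties using (++-commutativeMonoid; ++⁺; ++⁺ˡ; ++⁺ʳ; ++-comm; ∈-resp-↭; ↭-length) renaming (map⁺ to ↭-map⁺)
open import Data.List.Relation.Binary.Permutation.Setoid.Properties using (Unique-resp-↭)
open import Data.List.Relation.Binary.BagAndSetEquality using (∼bag⇒↭)
import Algebra.Solver.CommutativeMonoid as CMSolver
open import Function using (_∘_)
open import Function.Bundles using (_⇔_; mk⇔)
open import Relation.Binary.PropositionalEquality using (_≡_; _≢_; refl; sym; trans; cong; cong₂; subst; subst₂; setoid; module ≡-Reasoning)
open import Relation.Nullary using (¬_; Dec; yes; no; does; _⊎-dec_)

length-∷ʳ : ∀ {A : Set} (xs : List A) x → length (xs ++ [ x ]) ≡ suc (length xs)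
length-∷ʳ xs x = trans (length-++ xs) (+-comm (length xs) 1)

concatMap-∷ʳ : ∀ {A B : Set} (f : A → List B) xs x → concatMap f (xs ++ [ x ]) ≡ concatMap f xs ++ f x
concatMap-∷ʳ f xs x = trans (concatMap-++ f xs [ x ]) (cong (concatMap f xs ++_) (++-identityʳ (f x)))

concatMap-↭ : ∀ {A B : Set} (f : A → List B) {xs ys} → xs ↭ ys → concatMap f xs ↭ concatMap f ys
concatMap-↭ f ↭.refl              = ↭-refl
concatMap-↭ f (prep x p)          = ++⁺ˡ (f x) (concatMap-↭ f p)
concatMap-↭ f (swap x y p)        =
  ↭-trans (↭-reflexive (sym (++-assoc (f x) (f y) _)))
  (↭-trans (++⁺ (++-comm (f x) (f y)) (concatMap-↭ f p)) (↭-reflexive (++-assoc (f y) (f x) _)))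
concatMap-↭ f (↭.trans p q)       = ↭-trans (concatMap-↭ f p) (concatMap-↭ f q)

Unique-++ : ∀ {A : Set} {xs ys : List A} → Unique xs → Unique ys → (∀ {x y} → x ∈ xs → y ∈ ys → x ≢ y) →
            Unique (xs ++ ys)
Unique-++ u v sep = Unique.++⁺ u v (λ (p , q) → sep p q refl)

same-elements-↭ : ∀ {A : Set} {xs ys : List A} → Unique xs → Unique ys →
                  (∀ {x} → x ∈ xs → x ∈ ys) → (∀ {x} → x ∈ ys → x ∈ xs) → xs ↭ ys
same-elements-↭ u v to from = ∼bag⇒↭ (unique∧set⇒bag u v (mk⇔ to from))

Unique-lookup-injective : ∀ {A : Set} {xs : List A} → Unique xs → ∀ i j → List.lookup xs i ≡ List.lookup xs j → i ≡ j
Unique-lookup-injective (x∉ ∷ u) Fin.zero    Fin.zero    e = refl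
Unique-lookup-injective (x∉ ∷ u) Fin.zero    (Fin.suc j) e = ⊥-elim (All.lookup x∉ (∈-lookup j) e)
Unique-lookup-injective (x∉ ∷ u) (Fin.suc i) Fin.zero    e = ⊥-elim (All.lookup x∉ (∈-lookup i) (sym e))
Unique-lookup-injective (x∉ ∷ u) (Fin.suc i) (Fin.suc j) e = cong Fin.suc (Unique-lookup-injective u i j e)

range : ℕ → ℕ → List ℕ
range a zero    = []
range a (suc k) = a ∷ range (suc a) k

length-range : ∀ a k → length (range a k) ≡ k
length-range a zero    = refl
length-range a (suc k) = cong suc (length-range (suc a) k)

range-bounds : ∀ a k → All (λ x → a ≤ x × x < a + k) (range a k)
range-bounds a zero    = []
range-bounds a (suc k) =
  (≤-refl , subst (a <_) (sym (+-suc a k)) (s≤s (m≤m+n a k))) ∷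
  All.map (λ {x} (a<x , x<) → <⇒≤ a<x , subst (x <_) (sym (+-suc a k)) x<) (range-bounds (suc a) k)

range-∷ʳ : ∀ a k → range a (suc k) ≡ range a k ++ [ a + k ]
range-∷ʳ a zero    = cong [_] (sym (+-identityʳ a))
range-∷ʳ a (suc k) = cong (a ∷_) (trans (range-∷ʳ (suc a) k) (cong (λ x → range (suc a) k ++ [ x ]) (sym (+-suc a k))))

range-++ : ∀ a k l → range a (k + l) ≡ range a k ++ range (a + k) l
range-++ a zero    l = cong (λ x → range x l) (sym (+-identityʳ a))
range-++ a (suc k) l = cong (a ∷_) (trans (range-++ (suc a) k l) (cong (λ x → range (suc a) k ++ range x l) (sym (+-suc a k))))

map-range-cong : ∀ {A : Set} (f g : ℕ → A) a k → (∀ x → a ≤ x → x < a + k → f x ≡ g x) →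
                 map f (range a k) ≡ map g (range a k)
map-range-cong f g a zero    f≗g = refl
map-range-cong f g a (suc k) f≗g =
  cong₂ _∷_ (f≗g a ≤-refl (m<m+n a z<s))
            (map-range-cong f g (suc a) k (λ x a<x x< → f≗g x (<⇒≤ a<x) (subst (x <_) (sym (+-suc a k)) x<)))

∈-range⁻ : ∀ {x} a k → x ∈ range a k → a ≤ x × x < a + k
∈-range⁻ a k = All.lookup (range-bounds a k)

∈-range⁺ : ∀ {x} a k → a ≤ x → x < a + k → x ∈ range a k
∈-range⁺ {x} a zero    a≤x x< = ⊥-elim (<⇒≱ x< (subst (_≤ x) (sym (+-identityʳ a)) a≤x))
∈-range⁺ {x} a (suc k) a≤x x< with a ≟ x
... | yes refl = here refl
... | no a≢x   = there (∈-range⁺ (suc a) k (≤∧≢⇒< a≤x a≢x) (subst (x <_) (+-suc a k) x<))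

range-unique : ∀ a k → Unique (range a k)
range-unique a zero    = []
range-unique a (suc k) = All.map (λ (a<x , _) a≡x → <⇒≢ a<x a≡x) (range-bounds (suc a) k) ∷ range-unique (suc a) k

_∈⟨_,_⟩ : ℕ → ℕ → ℕ → Set
x ∈⟨ a , b ⟩ = x ≡ a ⊎ x ≡ b

_∈?⟨_,_⟩ : ∀ x a b → Dec (x ∈⟨ a , b ⟩)
x ∈?⟨ a , b ⟩ = x ≟ a ⊎-dec x ≟ b

exhaust : ∀ {u v p q w} → p ∈⟨ u , v ⟩ → q ∈⟨ u , v ⟩ → p ≢ q → w ∈⟨ u , v ⟩ → w ∈⟨ p , q ⟩
exhaust (inj₁ refl) (inj₁ refl) p≢q _           = ⊥-elim (p≢q refl)
exhaust (inj₂ refl) (inj₂ refl) p≢q _           = ⊥-elim (p≢q refl)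
exhaust (inj₁ refl) (inj₂ refl) _   (inj₁ refl) = inj₁ refl
exhaust (inj₁ refl) (inj₂ refl) _   (inj₂ refl) = inj₂ refl
exhaust (inj₂ refl) (inj₁ refl) _   (inj₁ refl) = inj₂ refl
exhaust (inj₂ refl) (inj₁ refl) _   (inj₂ refl) = inj₁ refl

module _ {P Q R : Set} where

  xor-onlyˡ : (p? : Dec P) (q? : Dec Q) (r? : Dec R) → does p? xor does q? ≡ does r? → P → ¬ Q → R
  xor-onlyˡ _       _       (yes r) _  _ _  = r
  xor-onlyˡ (no ¬p) _       _       _  p _  = ⊥-elim (¬p p)
  xor-onlyˡ (yes _) (yes q) _       _  _ ¬q = ⊥-elim (¬q q)
  xor-onlyˡ (yes _) (no _)  (no _)  () _ _

  xor-onlyʳ : (p? : Dec P) (q? : Dec Q) (r? : Dec R) → does p? xor does q? ≡ does r? → ¬ P → Q → R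
  xor-onlyʳ _       _       (yes r) _  _  _ = r
  xor-onlyʳ (yes p) _       _       _  ¬p _ = ⊥-elim (¬p p)
  xor-onlyʳ (no _)  (no ¬q) _       _  _  q = ⊥-elim (¬q q)
  xor-onlyʳ (no _)  (yes _) (no _)  () _  _

  xor-both : (p? : Dec P) (q? : Dec Q) (r? : Dec R) → does p? xor does q? ≡ does r? → P → Q → ¬ R
  xor-both (no ¬p) _       _       _  p _ _ = ¬p p
  xor-both (yes _) (no ¬q) _       _  _ q _ = ¬q q
  xor-both (yes _) (yes _) (no ¬r) _  _ _ r = ¬r r
  xor-both (yes _) (yes _) (yes _) () _ _ _

  xor-moved : (p? : Dec P) (q? : Dec Q) (r? : Dec R) → does p? xor does q? ≡ does r? → R → ¬ P → Q
  xor-moved _       (yes q) _       _  _ _  = q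
  xor-moved (yes p) _       _       _  _ ¬p = ⊥-elim (¬p p)
  xor-moved (no _)  (no _)  (no ¬r) _  r _  = ⊥-elim (¬r r)
  xor-moved (no _)  (no _)  (yes _) () _ _

-- Walk R a xs b: the list xs is a walk from a (excluded) to b (included).
data Walk {A : Set} (R : A → A → Set) : A → List A → A → Set where
  []  : ∀ {a} → Walk R a [] a
  _∷_ : ∀ {a b xs c} → R a b → Walk R b xs c → Walk R a (b ∷ xs) c

_▸_ : ∀ {A : Set} {R : A → A → Set} {a xs b ys c} → Walk R a xs b → Walk R b ys c → Walk R a (xs ++ ys) c
[] ▸ q = q
(r ∷ p) ▸ q = r ∷ (p ▸ q)

walk-map : ∀ {A B : Set} {R : A → A → Set} {S : B → B → Set} (f : A → B) → (∀ {x y} → R x y → S (f x) (f y)) →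
           ∀ {a xs b} → Walk R a xs b → Walk S (f a) (map f xs) (f b)
walk-map f R⇒S []      = []
walk-map f R⇒S (r ∷ w) = R⇒S r ∷ walk-map f R⇒S w

module _ {A : Set} {R : A → A → Set} where

  walk-first : ∀ {a xs b} → Walk R a xs b → (j : Fin (length xs)) → toℕ j ≡ 0 → R a (List.lookup xs j)
  walk-first (r ∷ _) Fin.zero _ = r

  walk-step : ∀ {a xs b} → Walk R a xs b → (i j : Fin (length xs)) → toℕ j ≡ suc (toℕ i) →
              R (List.lookup xs i) (List.lookup xs j)
  walk-step (_ ∷ w) Fin.zero    (Fin.suc j) e = walk-first w j (suc-injective e)
  walk-step (_ ∷ w) (Fin.suc i) (Fin.suc j) e = walk-step w i j (suc-injective e)

  walk-last : ∀ {a xs b} → Walk R a xs b → (i : Fin (length xs)) → suc (toℕ i) ≡ length xs → List.lookup xs i ≡ b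
  walk-last (_ ∷ [])    Fin.zero    _  = refl
  walk-last (_ ∷ _ ∷ _) Fin.zero    ()
  walk-last (_ ∷ w)     (Fin.suc i) e  = walk-last w i (suc-injective e)

next-cases : ∀ {K} (i : Fin (suc K)) → toℕ (next i) ≡ suc (toℕ i) ⊎ (next i ≡ Fin.zero × suc (toℕ i) ≡ suc K)
next-cases {K} i with suc (toℕ i) <? suc K
... | yes i+1<K = inj₁ (toℕ-fromℕ< i+1<K)
... | no i+1≮K  = inj₂ (refl , ≤-antisym (toℕ<n i) (≮⇒≥ i+1≮K))

next-inject₁ : ∀ {k} (i : Fin k) → next {suc k} (Fin.inject₁ i) ≡ Fin.suc i
next-inject₁ {k} i with next-cases {k} (Fin.inject₁ i)
... | inj₁ e       = toℕ-injective (trans e (cong suc (toℕ-inject₁ i)))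
... | inj₂ (_ , e) = ⊥-elim (<⇒≢ (toℕ<n i) (trans (sym (toℕ-inject₁ i)) (suc-injective e)))

next-last : ∀ k → next {suc k} (Fin.fromℕ k) ≡ Fin.zero
next-last k with next-cases {k} (Fin.fromℕ k)
... | inj₁ e        = ⊥-elim (<⇒≢ (toℕ<n (next {suc k} (Fin.fromℕ k))) (trans e (cong suc (toℕ-fromℕ k))))
... | inj₂ (e₀ , _) = e₀

module _ {A : Set} {R : A → A → Set} where

  tabulate-walk : ∀ k (h : Fin (suc k) → A) {a} → R a (h Fin.zero) →
                  (∀ (i : Fin k) → R (h (Fin.inject₁ i)) (h (Fin.suc i))) → Walk R a (List.tabulate h) (h (Fin.fromℕ k))
  tabulate-walk zero    h r₀ _    = r₀ ∷ []
  tabulate-walk (suc k) h r₀ step = r₀ ∷ tabulate-walk k (h ∘ Fin.suc) (step Fin.zero) (step ∘ Fin.suc)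

  cyclic-walk : ∀ k (h : Fin (suc k) → A) → (∀ i → R (h i) (h (next i))) →
                Walk R (h (Fin.fromℕ k)) (List.tabulate h) (h (Fin.fromℕ k))
  cyclic-walk k h step = tabulate-walk k h
    (subst (R (h (Fin.fromℕ k)) ∘ h) (next-last k) (step (Fin.fromℕ k)))
    (λ i → subst (R (h (Fin.inject₁ i)) ∘ h) (next-inject₁ i) (step (Fin.inject₁ i)))

-- Tokens and moves

data Vertex : Set where
  E P : ℕ → Vertex

-- A 2-subset of V(F_{m,n}) = {e_0 … e_{m-1}} ∪ {p_0 … p_{n-1}} is represented by a token:
-- ee i j = {e_i, e_j} with i < j, ep i j = {e_i, p_j}, pp i j = {p_i, p_j} with i < j.
data Token : Set where
  ee ep pp : ℕ → ℕ → Token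

members : Token → Vertex × Vertex
members (ee i j) = E i , E j
members (ep i j) = E i , P j
members (pp i j) = P i , P j

data FanEdge : Vertex → Vertex → Set where
  spoke  : ∀ i j → FanEdge (E i) (P j)
  spoke˘ : ∀ i j → FanEdge (P j) (E i)
  rim    : ∀ j → FanEdge (P j) (P (suc j))
  rim˘   : ∀ j → FanEdge (P (suc j)) (P j)

_∋_,_ : Token → Vertex → Vertex → Set
t ∋ u , v = members t ≡ (u , v) ⊎ members t ≡ (v , u)

record Move (t t′ : Token) : Set where
  constructor move
  field
    {stay from to} : Vertex
    edge      : FanEdge from to
    from≢stay : from ≢ stay
    to≢stay   : to ≢ stay
    before    : t ∋ stay , from
    after     : t′ ∋ stay , to

open CMSolver (++-commutativeMonoid {A = Token}) using (solve; _⊜_; _⊕_; id)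

-- x⇒y is a move from a token of kind x to one of kind y; ˘ marks that the moving
-- hub is the second member of the ee-token.
ep⇒ep : ∀ i p → Move (ep i p) (ep i (suc p))
ep⇒ep i p = move (rim p) (λ ()) (λ ()) (inj₁ refl) (inj₁ refl)

ep⇒ee : ∀ i p k → k ≢ i → Move (ep i p) (ee i k)
ep⇒ee i p k k≢i = move (spoke˘ k p) (λ ()) (λ { refl → k≢i refl }) (inj₁ refl) (inj₁ refl)

ep⇒ee˘ : ∀ i p k → k ≢ i → Move (ep i p) (ee k i)
ep⇒ee˘ i p k k≢i = move (spoke˘ k p) (λ ()) (λ { refl → k≢i refl }) (inj₁ refl) (inj₂ refl)

ee⇒ep : ∀ i p k → k ≢ i → Move (ee i k) (ep i p)
ee⇒ep i p k k≢i = move (spoke k p) (λ { refl → k≢i refl }) (λ ()) (inj₁ refl) (inj₁ refl)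

ee˘⇒ep : ∀ i p k → k ≢ i → Move (ee k i) (ep i p)
ee˘⇒ep i p k k≢i = move (spoke k p) (λ { refl → k≢i refl }) (λ ()) (inj₂ refl) (inj₁ refl)

ep⇒pp : ∀ i x y → y ≢ x → Move (ep i x) (pp x y)
ep⇒pp i x y y≢x = move (spoke i y) (λ ()) (λ { refl → y≢x refl }) (inj₂ refl) (inj₁ refl)

pp⇒ep : ∀ x i → Move (pp x (suc x)) (ep i (suc x))
pp⇒ep x i = move (spoke˘ i x) (λ ()) (λ ()) (inj₂ refl) (inj₂ refl)

pp⇒pp : ∀ x k → Move (pp x (suc (suc (k + x)))) (pp x (suc (k + x)))
pp⇒pp x k = move (rim˘ _) (λ e → m≢1+n+m x (sym (P-injective e))) (λ e → m≢1+n+m x (sym (P-injective e)))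
  (inj₁ refl) (inj₁ refl)
  where
  P-injective : ∀ {a b} → P a ≡ P b → a ≡ b
  P-injective refl = refl

ep⇒pp₀ : ∀ i k → Move (ep i (suc k)) (pp 0 (suc k))
ep⇒pp₀ i k = move (spoke i 0) (λ ()) (λ ()) (inj₂ refl) (inj₂ refl)

pp₀₁⇒ep₀₀ : Move (pp 0 1) (ep 0 0)
pp₀₁⇒ep₀₀ = move (spoke˘ 0 1) (λ ()) (λ ()) (inj₁ refl) (inj₂ refl)

Valid : ℕ → ℕ → Token → Set
Valid m n (ee i j) = i < j × j < m
Valid m n (ep i j) = i < m × j < n
Valid m n (pp i j) = i < j × j < n

ppRow : ℕ → ℕ → List Token
ppRow x zero    = []
ppRow x (suc k) = pp x (suc (k + x)) ∷ ppRow x k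

ppRows : ℕ → List ℕ → List Token
ppRows n = concatMap (λ x → ppRow x (n ∸ suc x))

epTokens : ℕ → ℕ → ℕ → List Token
epTokens i zero    n = []
epTokens i (suc k) n = map (ep i) (range 0 n) ++ epTokens (suc i) k n

allEE : ℕ → List Token
allEE zero    = []
allEE (suc m) = allEE m ++ map (λ i → ee i m) (range 0 m)

allPP : ℕ → List Token
allPP n = ppRows n (range 0 (n ∸ 1))

allTokens : ℕ → ℕ → List Token
allTokens m n = epTokens 0 m n ++ allEE m ++ allPP n

∈-epTokens⁻ : ∀ {t} a k n → t ∈ epTokens a k n → ∃₂ λ i j → t ≡ ep i j × a ≤ i × i < a + k × j < n
∈-epTokens⁻ a (suc k) n t∈ with ∈-++⁻ (map (ep a) (range 0 n)) t∈
... | inj₁ t∈row with ∈-map⁻ (ep a) t∈row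
...   | j , j∈ , refl = a , j , refl , ≤-refl , m<m+n a z<s , proj₂ (∈-range⁻ 0 n j∈)
∈-epTokens⁻ a (suc k) n t∈ | inj₂ t∈rest with ∈-epTokens⁻ (suc a) k n t∈rest
... | i , j , refl , a<i , i< , j<n = i , j , refl , <⇒≤ a<i , subst (i <_) (sym (+-suc a k)) i< , j<n

∈-epTokens⁺ : ∀ a k n i j → a ≤ i → i < a + k → j < n → ep i j ∈ epTokens a k n
∈-epTokens⁺ a zero    n i j a≤i i< j<n = ⊥-elim (<⇒≱ i< (subst (_≤ i) (sym (+-identityʳ a)) a≤i))
∈-epTokens⁺ a (suc k) n i j a≤i i< j<n with a ≟ i
... | yes refl = ∈-++⁺ˡ (∈-map⁺ (ep a) (∈-range⁺ 0 n z≤n j<n))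
... | no a≢i   = ∈-++⁺ʳ (map (ep a) (range 0 n))
                        (∈-epTokens⁺ (suc a) k n i j (≤∧≢⇒< a≤i a≢i) (subst (i <_) (+-suc a k) i<) j<n)

epTokens-unique : ∀ a k n → Unique (epTokens a k n)
epTokens-unique a zero    n = []
epTokens-unique a (suc k) n = Unique-++ (Unique.map⁺ (λ { refl → refl }) (range-unique 0 n)) (epTokens-unique (suc a) k n) sep
  where
  sep : ∀ {x y} → x ∈ map (ep a) (range 0 n) → y ∈ epTokens (suc a) k n → x ≢ y
  sep x∈ y∈ with ∈-map⁻ (ep a) x∈ | ∈-epTokens⁻ (suc a) k n y∈
  ... | _ , _ , refl | _ , _ , refl , a<i , _ = λ { refl → 1+n≰n a<i }

length-epTokens : ∀ a k n → length (epTokens a k n) ≡ k * n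
length-epTokens a zero    n = refl
length-epTokens a (suc k) n =
  trans (length-++ (map (ep a) (range 0 n)))
        (cong₂ _+_ (trans (length-map (ep a) (range 0 n)) (length-range 0 n)) (length-epTokens (suc a) k n))

∈-allEE⁻ : ∀ {t} m → t ∈ allEE m → ∃₂ λ i j → t ≡ ee i j × i < j × j < m
∈-allEE⁻ (suc m) t∈ with ∈-++⁻ (allEE m) t∈
... | inj₁ t∈old with ∈-allEE⁻ m t∈old
...   | i , j , refl , i<j , j<m = i , j , refl , i<j , m<n⇒m<1+n j<m
∈-allEE⁻ (suc m) t∈ | inj₂ t∈new with ∈-map⁻ (λ i → ee i m) t∈new
... | i , i∈ , refl = i , m , refl , proj₂ (∈-range⁻ 0 m i∈) , ≤-refl

∈-allEE⁺ : ∀ m i j → i < j → j < m → ee i j ∈ allEE m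
∈-allEE⁺ (suc m) i j i<j j<1+m with j ≟ m
... | yes refl = ∈-++⁺ʳ (allEE j) (∈-map⁺ (λ i → ee i j) (∈-range⁺ 0 j z≤n i<j))
... | no j≢m   = ∈-++⁺ˡ (∈-allEE⁺ m i j i<j (≤∧≢⇒< (s≤s⁻¹ j<1+m) j≢m))

allEE-unique : ∀ m → Unique (allEE m)
allEE-unique zero    = []
allEE-unique (suc m) = Unique-++ (allEE-unique m) (Unique.map⁺ (λ { refl → refl }) (range-unique 0 m)) sep
  where
  sep : ∀ {x y} → x ∈ allEE m → y ∈ map (λ i → ee i m) (range 0 m) → x ≢ y
  sep x∈ y∈ with ∈-allEE⁻ m x∈ | ∈-map⁻ (λ i → ee i m) y∈
  ... | _ , _ , refl , _ , j<m | _ , _ , refl = λ { refl → <-irrefl refl j<m }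

length-allEE : ∀ m → 2 * length (allEE m) + m ≡ m * m
length-allEE zero    = refl
length-allEE (suc m) = begin
  2 * length (allEE m ++ map (λ i → ee i m) (range 0 m)) + suc m
    ≡⟨ cong (λ k → 2 * k + suc m) (trans (length-++ (allEE m))
                                          (cong (length (allEE m) +_) (trans (length-map _ (range 0 m)) (length-range 0 m)))) ⟩
  2 * (length (allEE m) + m) + suc m
    ≡⟨ expand (length (allEE m)) m ⟩
  (2 * length (allEE m) + m) + (2 * m + 1)
    ≡⟨ cong (_+ (2 * m + 1)) (length-allEE m) ⟩
  m * m + (2 * m + 1)
    ≡⟨ square-suc m ⟩
  suc m * suc m ∎
  where
  open ≡-Reasoning
  expand : ∀ t m → 2 * (t + m) + suc m ≡ (2 * t + m) + (2 * m + 1)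
  expand = solve-∀
  square-suc : ∀ m → m * m + (2 * m + 1) ≡ suc m * suc m
  square-suc = solve-∀

∈-ppRow⁻ : ∀ {t} x k → t ∈ ppRow x k → ∃ λ y → t ≡ pp x y × x < y × y ≤ k + x
∈-ppRow⁻ x (suc k) (here refl) = suc (k + x) , refl , s≤s (m≤n+m x k) , ≤-refl
∈-ppRow⁻ x (suc k) (there t∈) with ∈-ppRow⁻ x k t∈
... | y , refl , x<y , y≤ = y , refl , x<y , m≤n⇒m≤1+n y≤

∈-ppRow⁺ : ∀ x k y → x < y → y ≤ k + x → pp x y ∈ ppRow x k
∈-ppRow⁺ x zero    y x<y y≤x = ⊥-elim (<⇒≱ x<y y≤x)
∈-ppRow⁺ x (suc k) y x<y y≤  with y ≟ suc (k + x)
... | yes refl = here refl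
... | no y≢    = there (∈-ppRow⁺ x k y x<y (s≤s⁻¹ (≤∧≢⇒< y≤ y≢)))

ppRow-unique : ∀ x k → Unique (ppRow x k)
ppRow-unique x zero    = []
ppRow-unique x (suc k) = All.tabulate top≢ ∷ ppRow-unique x k
  where
  top≢ : ∀ {t} → t ∈ ppRow x k → pp x (suc (k + x)) ≢ t
  top≢ t∈ with ∈-ppRow⁻ x k t∈
  ... | y , refl , _ , y≤ = λ { refl → 1+n≰n y≤ }

∈-ppRows⁻ : ∀ {t} n a k → t ∈ ppRows n (range a k) → ∃₂ λ x y → t ≡ pp x y × a ≤ x × x < y × y < n
∈-ppRows⁻ n a (suc k) t∈ with ∈-++⁻ (ppRow a (n ∸ suc a)) t∈
... | inj₁ t∈row with ∈-ppRow⁻ a (n ∸ suc a) t∈row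
...   | y , refl , a<y , y≤ = a , y , refl , ≤-refl , a<y , y<n
  where
  y<n : y < n
  y<n with suc a ≤? n
  ... | yes a<n = ≤-trans (s≤s y≤) (≤-reflexive (trans (sym (+-suc (n ∸ suc a) a)) (m∸n+n≡m a<n)))
  ... | no a≮n  = ⊥-elim (<⇒≱ a<y (subst (λ z → y ≤ z + a) (m≤n⇒m∸n≡0 (<⇒≤ (≰⇒> a≮n))) y≤))
∈-ppRows⁻ n a (suc k) t∈ | inj₂ t∈rest with ∈-ppRows⁻ n (suc a) k t∈rest
... | x , y , refl , a<x , x<y , y<n = x , y , refl , <⇒≤ a<x , x<y , y<n

∈-allPP⁺ : ∀ n x y → x < y → y < n → pp x y ∈ allPP n
∈-allPP⁺ n x y x<y y<n = go 0 (n ∸ 1) z≤n (≤-trans x<y (∸-monoˡ-≤ 1 y<n))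
  where
  y∈row : pp x y ∈ ppRow x (n ∸ suc x)
  y∈row = ∈-ppRow⁺ x (n ∸ suc x) y x<y
            (s≤s⁻¹ (subst (suc y ≤_) (trans (sym (m∸n+n≡m (≤-trans x<y (<⇒≤ y<n)))) (+-suc (n ∸ suc x) x)) y<n))
  go : ∀ a k → a ≤ x → x < a + k → pp x y ∈ ppRows n (range a k)
  go a zero    a≤x x< = ⊥-elim (<⇒≱ x< (subst (_≤ x) (sym (+-identityʳ a)) a≤x))
  go a (suc k) a≤x x< with a ≟ x
  ... | yes refl = ∈-++⁺ˡ y∈row
  ... | no a≢x   = ∈-++⁺ʳ (ppRow a (n ∸ suc a)) (go (suc a) k (≤∧≢⇒< a≤x a≢x) (subst (x <_) (+-suc a k) x<))

ppRows-unique : ∀ n a k → Unique (ppRows n (range a k))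
ppRows-unique n a zero    = []
ppRows-unique n a (suc k) = Unique-++ (ppRow-unique a (n ∸ suc a)) (ppRows-unique n (suc a) k) sep
  where
  sep : ∀ {t u} → t ∈ ppRow a (n ∸ suc a) → u ∈ ppRows n (range (suc a) k) → t ≢ u
  sep t∈ u∈ with ∈-ppRow⁻ a (n ∸ suc a) t∈ | ∈-ppRows⁻ n (suc a) k u∈
  ... | _ , refl , _ | _ , _ , refl , a<x , _ = λ { refl → 1+n≰n a<x }

allTokens-unique : ∀ m n → Unique (allTokens m n)
allTokens-unique m n =
  Unique-++ (epTokens-unique 0 m n) (Unique-++ (allEE-unique m) (ppRows-unique n 0 (n ∸ 1)) ee≢pp) ep≢other
  where
  ee≢pp : ∀ {t u} → t ∈ allEE m → u ∈ allPP n → t ≢ u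
  ee≢pp t∈ u∈ with ∈-allEE⁻ m t∈ | ∈-ppRows⁻ n 0 (n ∸ 1) u∈
  ... | _ , _ , refl , _ | _ , _ , refl , _ = λ ()
  ep≢other : ∀ {t u} → t ∈ epTokens 0 m n → u ∈ allEE m ++ allPP n → t ≢ u
  ep≢other t∈ u∈ with ∈-epTokens⁻ 0 m n t∈ | ∈-++⁻ (allEE m) u∈
  ... | _ , _ , refl , _ | inj₁ u∈ee with ∈-allEE⁻ m u∈ee
  ...   | _ , _ , refl , _ = λ ()
  ep≢other t∈ u∈ | _ , _ , refl , _ | inj₂ u∈pp with ∈-ppRows⁻ n 0 (n ∸ 1) u∈pp
  ...   | _ , _ , refl , _ = λ ()

∈-allTokens⁻ : ∀ {t} m n → t ∈ allTokens m n → Valid m n t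
∈-allTokens⁻ m n t∈ with ∈-++⁻ (epTokens 0 m n) t∈
... | inj₁ t∈ep with ∈-epTokens⁻ 0 m n t∈ep
...   | _ , _ , refl , _ , i<m , j<n = i<m , j<n
∈-allTokens⁻ m n t∈ | inj₂ t∈rest with ∈-++⁻ (allEE m) t∈rest
... | inj₁ t∈ee with ∈-allEE⁻ m t∈ee
...   | _ , _ , refl , i<j , j<m = i<j , j<m
∈-allTokens⁻ m n t∈ | inj₂ t∈rest | inj₂ t∈pp with ∈-ppRows⁻ n 0 (n ∸ 1) t∈pp
... | _ , _ , refl , _ , x<y , y<n = x<y , y<n

∈-allTokens⁺ : ∀ m n t → Valid m n t → t ∈ allTokens m n
∈-allTokens⁺ m n (ee i j) (i<j , j<m) = ∈-++⁺ʳ (epTokens 0 m n) (∈-++⁺ˡ (∈-allEE⁺ m i j i<j j<m))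
∈-allTokens⁺ m n (ep i j) (i<m , j<n) = ∈-++⁺ˡ (∈-epTokens⁺ 0 m n i j z≤n i<m j<n)
∈-allTokens⁺ m n (pp x y) (x<y , y<n) = ∈-++⁺ʳ (epTokens 0 m n) (∈-++⁺ʳ (allEE m) (∈-allPP⁺ n x y x<y y<n))

-- Itineraries of the hubs

-- Hub i carries its token along the path, through
-- ep i 0 … ep i (n-1); between p_q and p_{q+1} it may detour through the pp-row
-- {p_q, p_y}, y = n-1 … q+1, or through the ee-vertex {e_i, e_k}. Consecutive hubs are
-- joined through {e_i, e_{i+1}}, and the cycle closes through the row {p_0, p_y}.
data Gap : Set where
  skip row : Gap
  above below : ℕ → Gap

Design : Set
Design = List (List Gap)

gapTokens : ℕ → ℕ → ℕ → Gap → List Token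
gapTokens i q n skip      = []
gapTokens i q n row       = ppRow q (n ∸ suc q)
gapTokens i q n (above k) = [ ee i k ]
gapTokens i q n (below k) = [ ee k i ]

segmentFrom : ℕ → ℕ → ℕ → List Gap → List Token
segmentFrom i q n []       = []
segmentFrom i q n (g ∷ gs) = gapTokens i q n g ++ ep i (suc q) ∷ segmentFrom i (suc q) n gs

segment : ℕ → ℕ → List Gap → List Token
segment i n gs = ep i 0 ∷ segmentFrom i 0 n gs

tour : ℕ → ℕ → Design → List Token
tour i n []             = []
tour i n (gs ∷ [])      = segment i n gs ++ ppRow 0 (n ∸ 1)
tour i n (gs ∷ hs ∷ D)  = segment i n gs ++ ee i (suc i) ∷ tour (suc i) n (hs ∷ D)

GapOk : ℕ → Gap → Set
GapOk i (above k) = k ≢ i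
GapOk i (below k) = k ≢ i
GapOk i _         = ⊤

WellFormed : ℕ → ℕ → Design → Set
WellFormed i n []       = ⊤
WellFormed i n (gs ∷ D) = (All (GapOk i) gs × suc (length gs) ≡ n) × WellFormed (suc i) n D

ppRow-walk : ∀ x k → Walk Move (pp x (suc (k + x))) (ppRow x k) (pp x (suc x))
ppRow-walk x zero    = []
ppRow-walk x (suc k) = pp⇒pp x k ∷ ppRow-walk x k

gap-walk : ∀ i q n g → GapOk i g → Walk Move (ep i q) (gapTokens i q n g ++ [ ep i (suc q) ]) (ep i (suc q))
gap-walk i q n skip _ = ep⇒ep i q ∷ []
gap-walk i q n row _ with n ∸ suc q
... | zero  = ep⇒ep i q ∷ []
... | suc k = ep⇒pp i q (suc (k + q)) (λ e → m≢1+n+m q (sym e)) ∷ (ppRow-walk q k ▸ (pp⇒ep q i ∷ []))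
gap-walk i q n (above k) k≢i = ep⇒ee i q k k≢i ∷ ee⇒ep i (suc q) k k≢i ∷ []
gap-walk i q n (below k) k≢i = ep⇒ee˘ i q k k≢i ∷ ee˘⇒ep i (suc q) k k≢i ∷ []

segmentFrom-walk : ∀ i q n gs → All (GapOk i) gs → Walk Move (ep i q) (segmentFrom i q n gs) (ep i (length gs + q))
segmentFrom-walk i q n [] [] = []
segmentFrom-walk i q n (g ∷ gs) (ok ∷ oks) =
  subst (λ xs → Walk Move (ep i q) xs (ep i (suc (length gs + q))))
        (++-assoc (gapTokens i q n g) [ ep i (suc q) ] (segmentFrom i (suc q) n gs))
        (gap-walk i q n g ok ▸ subst (Walk Move (ep i (suc q)) (segmentFrom i (suc q) n gs) ∘ ep i)
                                     (+-suc (length gs) q) (segmentFrom-walk i (suc q) n gs oks))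

segment-walk : ∀ {t} i n gs → All (GapOk i) gs → Move t (ep i 0) → Walk Move t (segment i n gs) (ep i (length gs))
segment-walk i n gs oks r =
  r ∷ subst (Walk Move (ep i 0) (segmentFrom i 0 n gs) ∘ ep i) (+-identityʳ _) (segmentFrom-walk i 0 n gs oks)

tour-walk : ∀ {t} i n gs D → WellFormed i (suc (suc n)) (gs ∷ D) → Move t (ep i 0) →
            Walk Move t (tour i (suc (suc n)) (gs ∷ D)) (pp 0 1)
tour-walk i n gs [] ((oks , len) , _) r =
  subst (λ x → Walk Move _ (segment i (suc (suc n)) gs) (ep i x)) (trans (suc-injective len) (cong suc (sym (+-identityʳ n))))
        (segment-walk i _ gs oks r) ▸
  (ep⇒pp₀ i (n + 0) ∷ ppRow-walk 0 n)
tour-walk i n gs (hs ∷ D) ((oks , _) , wf) r =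
  segment-walk i _ gs oks r ▸
  (ep⇒ee i _ (suc i) 1+n≢n ∷ tour-walk (suc i) n hs D wf (ee˘⇒ep (suc i) 0 i (λ e → 1+n≢n (sym e))))

tour-closed : ∀ n gs D → WellFormed 0 (suc (suc n)) (gs ∷ D) → Walk Move (pp 0 1) (tour 0 (suc (suc n)) (gs ∷ D)) (pp 0 1)
tour-closed n gs D wf = tour-walk 0 n gs D wf pp₀₁⇒ep₀₀

gapEE : ℕ → Gap → List Token
gapEE i (above k) = [ ee i k ]
gapEE i (below k) = [ ee k i ]
gapEE i _         = []

gapRowPositions : ℕ → Gap → List ℕ
gapRowPositions q row = [ q ]
gapRowPositions q _   = []

rowPositions : ℕ → List Gap → List ℕ
rowPositions q []       = []
rowPositions q (g ∷ gs) = gapRowPositions q g ++ rowPositions (suc q) gs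

designEE : ℕ → Design → List Token
designEE i []       = []
designEE i (gs ∷ D) = concatMap (gapEE i) gs ++ designEE (suc i) D

designRows : Design → List ℕ
designRows = concatMap (rowPositions 0)

handovers : ℕ → ℕ → List Token
handovers i (suc (suc k)) = ee i (suc i) ∷ handovers (suc i) (suc k)
handovers i _             = []

move-to-rows : (r x a b c : List Token) → r ++ x ++ a ++ b ++ c ↭ x ++ a ++ b ++ r ++ c
move-to-rows = solve 5 (λ r x a b c → r ⊕ (x ⊕ (a ⊕ (b ⊕ c))) ⊜ x ⊕ (a ⊕ (b ⊕ (r ⊕ c)))) ↭-refl

move-to-EE : (r x a b c : List Token) → r ++ x ++ a ++ b ++ c ↭ x ++ a ++ (r ++ b) ++ c
move-to-EE = solve 5 (λ r x a b c → r ⊕ (x ⊕ (a ⊕ (b ⊕ c))) ⊜ x ⊕ (a ⊕ ((r ⊕ b) ⊕ c))) ↭-refl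

regroup : (x a b′ b a′ h e₁ e₂ : List Token) →
  ((x ++ a ++ b′) ++ b ++ a′) ++ (h ++ e₁) ++ e₂ ↭ ((x ++ h) ++ a ++ b ++ e₁) ++ a′ ++ b′ ++ e₂
regroup = solve 8 (λ x a b′ b a′ h e₁ e₂ → ((x ⊕ (a ⊕ b′)) ⊕ (b ⊕ a′)) ⊕ ((h ⊕ e₁) ⊕ e₂)
                                        ⊜ ((x ⊕ h) ⊕ (a ⊕ (b ⊕ e₁))) ⊕ (a′ ⊕ (b′ ⊕ e₂))) ↭-refl

interchange : (a b c d : List Token) → (a ++ b) ++ c ++ d ↭ (a ++ c) ++ b ++ d
interchange = solve 4 (λ a b c d → (a ⊕ b) ⊕ (c ⊕ d) ⊜ (a ⊕ c) ⊕ (b ⊕ d)) ↭-refl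

segmentFrom-↭ : ∀ i q n gs → segmentFrom i q n gs ↭
  map (ep i) (range (suc q) (length gs)) ++ concatMap (gapEE i) gs ++ ppRows n (rowPositions q gs)
segmentFrom-↭ i q n []       = ↭-refl
segmentFrom-↭ i q n (g ∷ gs) = ↭-trans (++⁺ˡ (gapTokens i q n g) (prep _ (segmentFrom-↭ i (suc q) n gs))) (place g)
  where
  x = [ ep i (suc q) ]
  a = map (ep i) (range (suc (suc q)) (length gs))
  b = concatMap (gapEE i) gs
  c = ppRows n (rowPositions (suc q) gs)
  place : ∀ g → gapTokens i q n g ++ x ++ a ++ b ++ c ↭
                x ++ a ++ (gapEE i g ++ b) ++ ppRows n (rowPositions q (g ∷ gs))
  place skip      = ↭-refl
  place row       = move-to-rows (ppRow q (n ∸ suc q)) x a b c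
  place (above k) = move-to-EE [ ee i k ] x a b c
  place (below k) = move-to-EE [ ee k i ] x a b c

segment-↭ : ∀ i n gs → segment i n gs ↭
  map (ep i) (range 0 (suc (length gs))) ++ concatMap (gapEE i) gs ++ ppRows n (rowPositions 0 gs)
segment-↭ i n gs = prep (ep i 0) (segmentFrom-↭ i 0 n gs)

tour-↭ : ∀ i n gs D → WellFormed i n (gs ∷ D) → tour i n (gs ∷ D) ↭
  epTokens i (length (gs ∷ D)) n ++ designEE i (gs ∷ D) ++ handovers i (length (gs ∷ D)) ++
  ppRows n (designRows (gs ∷ D)) ++ ppRow 0 (n ∸ 1)
tour-↭ i _ gs [] ((_ , refl) , _) =
  ↭-trans (++⁺ʳ r (segment-↭ i n gs))
  (↭-trans (shuffle (map (ep i) (range 0 n)) (concatMap (gapEE i) gs) (ppRows n (rowPositions 0 gs)) r)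
  (↭-reflexive (cong (λ xs → (map (ep i) (range 0 n) ++ []) ++ (concatMap (gapEE i) gs ++ []) ++ ppRows n xs ++ r)
                     (sym (++-identityʳ (rowPositions 0 gs))))))
  where
  n = suc (length gs)
  r = ppRow 0 (n ∸ 1)
  shuffle : (a b c r : List Token) → (a ++ b ++ c) ++ r ↭ (a ++ []) ++ (b ++ []) ++ c ++ r
  shuffle = solve 4 (λ a b c r → (a ⊕ (b ⊕ c)) ⊕ r ⊜ (a ⊕ id) ⊕ ((b ⊕ id) ⊕ (c ⊕ r))) ↭-refl
tour-↭ i _ gs (hs ∷ D) ((_ , refl) , wf) =
  ↭-trans (++⁺ (segment-↭ i n gs) (prep (ee i (suc i)) (tour-↭ (suc i) n hs D wf)))
  (↭-trans (shuffle a b c [ ee i (suc i) ] a′ b′ h′ c′ r)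
  (↭-reflexive (cong (λ xs → (a ++ a′) ++ (b ++ b′) ++ (ee i (suc i) ∷ h′) ++ xs ++ r)
                     (sym (concatMap-++ (λ x → ppRow x (n ∸ suc x)) (rowPositions 0 gs) (designRows (hs ∷ D)))))))
  where
  n = suc (length gs)
  a = map (ep i) (range 0 n)
  b = concatMap (gapEE i) gs
  c = ppRows n (rowPositions 0 gs)
  a′ = epTokens (suc i) (length (hs ∷ D)) n
  b′ = designEE (suc i) (hs ∷ D)
  h′ = handovers (suc i) (length (hs ∷ D))
  c′ = ppRows n (designRows (hs ∷ D))
  r = ppRow 0 (n ∸ 1)
  shuffle : (a b c x a′ b′ h′ c′ r : List Token) →
    (a ++ b ++ c) ++ x ++ a′ ++ b′ ++ h′ ++ c′ ++ r ↭ (a ++ a′) ++ (b ++ b′) ++ (x ++ h′) ++ (c ++ c′) ++ r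
  shuffle = solve 9 (λ a b c x a′ b′ h′ c′ r → (a ⊕ (b ⊕ c)) ⊕ (x ⊕ (a′ ⊕ (b′ ⊕ (h′ ⊕ (c′ ⊕ r)))))
                                             ⊜ (a ⊕ a′) ⊕ ((b ⊕ b′) ⊕ ((x ⊕ h′) ⊕ ((c ⊕ c′) ⊕ r)))) ↭-refl

-- A design for F_{m,n}: m segments whose ee-detours and hand-overs cover every ee-token
-- once, and whose pp-rows, together with the closing row at position 0, cover every
-- position 0 … n-2 once.
Admissible : ℕ → ℕ → Design → Set
Admissible m n D = WellFormed 0 n D × length D ≡ m × (designEE 0 D ++ handovers 0 m ↭ allEE m) ×
                   (0 ∷ designRows D ↭ range 0 (n ∸ 1))

tour-↭-allTokens : ∀ m n gs D → Admissible m n (gs ∷ D) → tour 0 n (gs ∷ D) ↭ allTokens m n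
tour-↭-allTokens m n gs D (wf , refl , ee↭ , rows↭) =
  ↭-trans (tour-↭ 0 n gs D wf)
  (++⁺ˡ (epTokens 0 m n)
    (↭-trans (↭-reflexive (sym (++-assoc (designEE 0 (gs ∷ D)) (handovers 0 m) _)))
    (++⁺ ee↭ (↭-trans (++-comm (ppRows n (designRows (gs ∷ D))) (ppRow 0 (n ∸ 1)))
                      (concatMap-↭ (λ x → ppRow x (n ∸ suc x)) rows↭)))))

-- Growing admissible designs

rowPositions-++ : ∀ q gs hs → rowPositions q (gs ++ hs) ≡ rowPositions q gs ++ rowPositions (length gs + q) hs
rowPositions-++ q []       hs = refl
rowPositions-++ q (g ∷ gs) hs = begin
  gapRowPositions q g ++ rowPositions (suc q) (gs ++ hs)
    ≡⟨ cong (gapRowPositions q g ++_) (rowPositions-++ (suc q) gs hs) ⟩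
  gapRowPositions q g ++ rowPositions (suc q) gs ++ rowPositions (length gs + suc q) hs
    ≡⟨ sym (++-assoc (gapRowPositions q g) _ _) ⟩
  (gapRowPositions q g ++ rowPositions (suc q) gs) ++ rowPositions (length gs + suc q) hs
    ≡⟨ cong (λ x → (gapRowPositions q g ++ rowPositions (suc q) gs) ++ rowPositions x hs) (+-suc (length gs) q) ⟩
  (gapRowPositions q g ++ rowPositions (suc q) gs) ++ rowPositions (suc (length gs + q)) hs ∎
  where open ≡-Reasoning

rowPositions-∷ʳ : ∀ gs g → rowPositions 0 (gs ++ [ g ]) ≡ rowPositions 0 gs ++ gapRowPositions (length gs) g
rowPositions-∷ʳ gs g = trans (rowPositions-++ 0 gs [ g ])
  (cong (rowPositions 0 gs ++_) (trans (++-identityʳ _) (cong (λ x → gapRowPositions x g) (+-identityʳ _))))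

lengthenPath : Design → Design
lengthenPath []       = []
lengthenPath (gs ∷ D) = (gs ++ [ row ]) ∷ map (_++ [ skip ]) D

wellFormed-skip : ∀ i n D → WellFormed i n D → WellFormed i (suc n) (map (_++ [ skip ]) D)
wellFormed-skip i n []       _                    = tt
wellFormed-skip i n (gs ∷ D) ((oks , len) , wf) =
  (∷ʳ⁺ oks tt , cong suc (trans (length-∷ʳ gs skip) len)) , wellFormed-skip (suc i) n D wf

designEE-skip : ∀ i D → designEE i (map (_++ [ skip ]) D) ≡ designEE i D
designEE-skip i []       = refl
designEE-skip i (gs ∷ D) =
  cong₂ _++_ (trans (concatMap-∷ʳ (gapEE i) gs skip) (++-identityʳ _)) (designEE-skip (suc i) D)

designRows-skip : ∀ D → designRows (map (_++ [ skip ]) D) ≡ designRows D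
designRows-skip []       = refl
designRows-skip (gs ∷ D) = cong₂ _++_ (trans (rowPositions-∷ʳ gs skip) (++-identityʳ _)) (designRows-skip D)

lengthenPath-admissible : ∀ m n D → 1 ≤ m → Admissible m n D → Admissible m (suc n) (lengthenPath D)
lengthenPath-admissible m n [] m≥1 (_ , refl , _) = ⊥-elim (1+n≰n m≥1)
lengthenPath-admissible m n (gs ∷ D) _ (((oks , len) , wf) , length≡ , ee↭ , rows↭) =
  ((∷ʳ⁺ oks tt , cong suc (trans (length-∷ʳ gs row) len)) , wellFormed-skip 1 n D wf) ,
  trans (cong suc (length-map _ D)) length≡ ,
  subst (λ xs → xs ++ handovers 0 m ↭ allEE m)
        (sym (cong₂ _++_ (trans (concatMap-∷ʳ (gapEE 0) gs row) (++-identityʳ _)) (designEE-skip 1 D))) ee↭ ,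
  subst (λ xs → 0 ∷ xs ↭ range 0 n) (sym (cong₂ _++_ (rowPositions-∷ʳ gs row) (designRows-skip D))) rows↭′
  where
  open CMSolver (++-commutativeMonoid {A = ℕ}) using () renaming (solve to solveℕ; _⊜_ to _⊜ℕ_; _⊕_ to _⊕ℕ_)
  L = length gs
  rows↭′ : 0 ∷ (rowPositions 0 gs ++ [ L ]) ++ designRows D ↭ range 0 n
  rows↭′ = ↭-trans (solveℕ 4 (λ z r l d → z ⊕ℕ ((r ⊕ℕ l) ⊕ℕ d) ⊜ℕ (z ⊕ℕ (r ⊕ℕ d)) ⊕ℕ l) ↭-refl
                      [ 0 ] (rowPositions 0 gs) [ L ] (designRows D))
           (↭-trans (++⁺ʳ [ L ] (subst (λ k → 0 ∷ designRows (gs ∷ D) ↭ range 0 (k ∸ 1)) (sym len) rows↭))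
                    (↭-reflexive (trans (sym (range-∷ʳ 0 L)) (cong (range 0) len))))

-- Adding hubs m and m+1, where m = 1 + h + c: old hub j detours through e_m if j < h and
-- through e_{m+1} otherwise, hub m visits e_h … e_{m-2} and the new pp-row at position
-- n - 1, and hub m+1 visits e_0 … e_{h-1}; the hand-overs supply {e_{m-1}, e_m} and
-- {e_m, e_{m+1}}.
partner : ℕ → ℕ → ℕ → ℕ
partner h m j with j <? h
... | yes _ = m
... | no _  = suc m

addAbove : ℕ → ℕ → ℕ → Design → Design
addAbove h m i []       = []
addAbove h m i (gs ∷ D) = (gs ++ [ above (partner h m i) ]) ∷ addAbove h m (suc i) D

length-addAbove : ∀ h m i D → length (addAbove h m i D) ≡ length D
length-addAbove h m i []       = refl
length-addAbove h m i (gs ∷ D) = cong suc (length-addAbove h m (suc i) D)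

firstNewHub : ℕ → ℕ → ℕ → List Gap
firstNewHub h c n = map below (range h c) ++ replicate (n ∸ suc c) skip ++ [ row ]

secondNewHub : ℕ → ℕ → List Gap
secondNewHub h n = map below (range 0 h) ++ replicate (n ∸ h) skip

addTwoHubs : ℕ → ℕ → ℕ → Design → Design
addTwoHubs h c n D = addAbove h (suc (h + c)) 0 D ++ firstNewHub h c n ∷ secondNewHub h n ∷ []

wellFormed-++ : ∀ i n D₁ D₂ → WellFormed i n D₁ → WellFormed (i + length D₁) n D₂ → WellFormed i n (D₁ ++ D₂)
wellFormed-++ i n []        D₂ _          wf₂ = subst (λ x → WellFormed x n D₂) (+-identityʳ i) wf₂
wellFormed-++ i n (gs ∷ D₁) D₂ (ok , wf₁) wf₂ =
  ok , wellFormed-++ (suc i) n D₁ D₂ wf₁ (subst (λ x → WellFormed x n D₂) (+-suc i (length D₁)) wf₂)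

partner≢ : ∀ h m j → j < m → partner h m j ≢ j
partner≢ h m j j<m with j <? h
... | yes _ = λ e → <⇒≢ j<m (sym e)
... | no _  = λ e → <⇒≢ (m<n⇒m<1+n j<m) (sym e)

wellFormed-addAbove : ∀ h m n i D → WellFormed i n D → i + length D ≡ m → WellFormed i (suc n) (addAbove h m i D)
wellFormed-addAbove h m n i []       _                 _   = tt
wellFormed-addAbove h m n i (gs ∷ D) ((oks , len) , wf) end =
  (∷ʳ⁺ oks (partner≢ h m i i<m) , cong suc (trans (length-∷ʳ gs _) len)) ,
  wellFormed-addAbove h m n (suc i) D wf (trans (sym (+-suc i (length D))) end)
  where
  i<m : i < m
  i<m = subst (i <_) end (≤-trans (s≤s (m≤m+n i (length D))) (≤-reflexive (sym (+-suc i (length D)))))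

below-ok : ∀ i a k → a + k ≤ i → All (GapOk i) (map below (range a k))
below-ok i a k a+k≤i = map⁺ (All.map (λ (_ , x<) e → <⇒≢ (≤-trans x< a+k≤i) e) (range-bounds a k))

length-firstNewHub : ∀ h c n → c < n → length (firstNewHub h c n) ≡ n
length-firstNewHub h c n c<n = begin
  length (map below (range h c) ++ replicate (n ∸ suc c) skip ++ [ row ])
    ≡⟨ length-++ (map below (range h c)) ⟩
  length (map below (range h c)) + length (replicate (n ∸ suc c) skip ++ [ row ])
    ≡⟨ cong₂ _+_ (trans (length-map below (range h c)) (length-range h c))
                 (trans (length-∷ʳ (replicate (n ∸ suc c) skip) row) (cong suc (length-replicate (n ∸ suc c)))) ⟩
  c + suc (n ∸ suc c)
    ≡⟨ +-suc c (n ∸ suc c) ⟩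
  suc c + (n ∸ suc c)
    ≡⟨ m+[n∸m]≡n c<n ⟩
  n ∎
  where open ≡-Reasoning

length-secondNewHub : ∀ h n → h ≤ n → length (secondNewHub h n) ≡ n
length-secondNewHub h n h≤n =
  trans (length-++ (map below (range 0 h)))
        (trans (cong₂ _+_ (trans (length-map below (range 0 h)) (length-range 0 h)) (length-replicate (n ∸ h)))
               (m+[n∸m]≡n h≤n))

wellFormed-addTwoHubs : ∀ h c n D → c < n → h ≤ n → WellFormed 0 n D → length D ≡ suc (h + c) →
                        WellFormed 0 (suc n) (addTwoHubs h c n D)
wellFormed-addTwoHubs h c n D c<n h≤n wf len =
  wellFormed-++ 0 (suc n) (addAbove h m 0 D) _ (wellFormed-addAbove h m n 0 D wf len)
    (subst (λ x → WellFormed x (suc n) (firstNewHub h c n ∷ secondNewHub h n ∷ [])) (sym (trans (length-addAbove h m 0 D) len))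
      ((All-++⁺ (below-ok m h c (n≤1+n _)) (All-++⁺ (replicate⁺ _ tt) (tt ∷ [])) , cong suc (length-firstNewHub h c n c<n)) ,
       (All-++⁺ (below-ok (suc m) 0 h (≤-trans (m≤m+n h c) (≤-trans (n≤1+n _) (n≤1+n _)))) (replicate⁺ _ tt) ,
        cong suc (length-secondNewHub h n h≤n)) , tt))
  where
  m = suc (h + c)

handovers-∷ʳ : ∀ i k → handovers i (suc (suc k)) ≡ handovers i (suc k) ++ [ ee (i + k) (suc (i + k)) ]
handovers-∷ʳ i zero    = cong (λ x → [ ee x (suc x) ]) (sym (+-identityʳ i))
handovers-∷ʳ i (suc k) = cong (ee i (suc i) ∷_)
  (trans (handovers-∷ʳ (suc i) k) (cong (λ x → handovers (suc i) (suc k) ++ [ ee x (suc x) ]) (sym (+-suc i k))))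

designEE-++ : ∀ i D₁ D₂ → designEE i (D₁ ++ D₂) ≡ designEE i D₁ ++ designEE (i + length D₁) D₂
designEE-++ i []        D₂ = cong (λ x → designEE x D₂) (sym (+-identityʳ i))
designEE-++ i (gs ∷ D₁) D₂ =
  trans (cong (concatMap (gapEE i) gs ++_)
              (trans (designEE-++ (suc i) D₁ D₂)
                     (cong (λ x → designEE (suc i) D₁ ++ designEE x D₂) (sym (+-suc i (length D₁))))))
        (sym (++-assoc (concatMap (gapEE i) gs) _ _))

designEE-addAbove : ∀ h m i D →
  designEE i (addAbove h m i D) ↭ designEE i D ++ map (λ j → ee j (partner h m j)) (range i (length D))
designEE-addAbove h m i []       = ↭-refl
designEE-addAbove h m i (gs ∷ D) = begin
  concatMap (gapEE i) (gs ++ [ above (partner h m i) ]) ++ designEE (suc i) (addAbove h m (suc i) D)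
    ≡⟨ cong (_++ designEE (suc i) (addAbove h m (suc i) D)) (concatMap-∷ʳ (gapEE i) gs _) ⟩
  (concatMap (gapEE i) gs ++ [ ee i (partner h m i) ]) ++ designEE (suc i) (addAbove h m (suc i) D)
    ↭⟨ ++⁺ˡ (concatMap (gapEE i) gs ++ [ ee i (partner h m i) ]) (designEE-addAbove h m (suc i) D) ⟩
  (concatMap (gapEE i) gs ++ [ ee i (partner h m i) ]) ++ designEE (suc i) D ++ partners
    ↭⟨ interchange (concatMap (gapEE i) gs) [ ee i (partner h m i) ] (designEE (suc i) D) partners ⟩
  (concatMap (gapEE i) gs ++ designEE (suc i) D) ++ ee i (partner h m i) ∷ partners ∎
  where
  open PermutationReasoning
  partners = map (λ j → ee j (partner h m j)) (range (suc i) (length D))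

gapEE-below : ∀ i xs gs → concatMap (gapEE i) (map below xs ++ gs) ≡ map (λ x → ee x i) xs ++ concatMap (gapEE i) gs
gapEE-below i []       gs = refl
gapEE-below i (x ∷ xs) gs = cong (ee x i ∷_) (gapEE-below i xs gs)

gapEE-skips : ∀ i k → concatMap (gapEE i) (replicate k skip) ≡ []
gapEE-skips i zero    = refl
gapEE-skips i (suc k) = gapEE-skips i k

range-split : ∀ h c → range 0 (suc (h + c)) ≡ range 0 h ++ range h (suc c)
range-split h c = trans (cong (range 0) (sym (+-suc h c))) (range-++ 0 h (suc c))

module _ (h c : ℕ) where
  private
    m = suc (h + c)

  partners-split : map (λ j → ee j (partner h m j)) (range 0 m) ≡
                   map (λ j → ee j m) (range 0 h) ++ map (λ j → ee j (suc m)) (range h (suc c))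
  partners-split =
    trans (cong (map (λ j → ee j (partner h m j))) (range-split h c))
    (trans (map-++ (λ j → ee j (partner h m j)) (range 0 h) (range h (suc c)))
           (cong₂ _++_ (map-range-cong _ _ 0 h (λ j _ j<h → cong (ee j) (partner-low j j<h)))
                       (map-range-cong _ _ h (suc c) (λ j h≤j _ → cong (ee j) (partner-high j h≤j)))))
    where
    partner-low : ∀ j → j < h → partner h m j ≡ m
    partner-low j j<h with j <? h
    ... | yes _   = refl
    ... | no j≮h  = ⊥-elim (j≮h j<h)
    partner-high : ∀ j → h ≤ j → partner h m j ≡ suc m
    partner-high j h≤j with j <? h
    ... | yes j<h = ⊥-elim (<⇒≱ j<h h≤j)
    ... | no _    = refl

  eeTo-split : map (λ j → ee j m) (range 0 m) ≡
               map (λ j → ee j m) (range 0 h) ++ map (λ j → ee j m) (range h c) ++ [ ee (h + c) m ]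
  eeTo-split =
    trans (cong (map (λ j → ee j m)) (range-split h c))
    (trans (map-++ (λ j → ee j m) (range 0 h) (range h (suc c)))
           (cong (map (λ j → ee j m) (range 0 h) ++_)
                 (trans (cong (map (λ j → ee j m)) (range-∷ʳ h c)) (map-++ (λ j → ee j m) (range h c) _))))

  eeToNext-split : map (λ j → ee j (suc m)) (range 0 (suc m)) ≡
                   map (λ j → ee j (suc m)) (range 0 h) ++ map (λ j → ee j (suc m)) (range h (suc c)) ++ [ ee m (suc m) ]
  eeToNext-split =
    trans (cong (map (λ j → ee j (suc m))) (trans (range-∷ʳ 0 m) (cong (_++ [ m ]) (range-split h c))))
    (trans (map-++ (λ j → ee j (suc m)) (range 0 h ++ range h (suc c)) [ m ])
    (trans (cong (_++ [ ee m (suc m) ]) (map-++ (λ j → ee j (suc m)) (range 0 h) (range h (suc c))))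
           (++-assoc (map (λ j → ee j (suc m)) (range 0 h)) _ _)))

  designEE-newHubs : ∀ n → designEE m (firstNewHub h c n ∷ secondNewHub h n ∷ []) ≡
                     map (λ j → ee j m) (range h c) ++ map (λ j → ee j (suc m)) (range 0 h)
  designEE-newHubs n = cong₂ _++_
    (trans (gapEE-below m (range h c) _)
           (trans (cong (map (λ j → ee j m) (range h c) ++_)
                        (trans (concatMap-++ (gapEE m) (replicate (n ∸ suc c) skip) [ row ])
                               (cong (_++ []) (gapEE-skips m (n ∸ suc c)))))
                  (++-identityʳ _)))
    (trans (cong (_++ []) (trans (gapEE-below (suc m) (range 0 h) _) (cong (_ ++_) (gapEE-skips (suc m) (n ∸ h)))))
           (trans (++-identityʳ _) (++-identityʳ _)))

  addTwoHubs-EE : ∀ n D → length D ≡ m → designEE 0 D ++ handovers 0 m ↭ allEE m →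
                  designEE 0 (addTwoHubs h c n D) ++ handovers 0 (suc (suc m)) ↭ allEE (suc (suc m))
  addTwoHubs-EE n D len ee↭ = begin
    designEE 0 (addAbove h m 0 D ++ firstNewHub h c n ∷ secondNewHub h n ∷ []) ++ handovers 0 (suc (suc m))
      ≡⟨ cong₂ _++_ (trans (designEE-++ 0 (addAbove h m 0 D) _)
                           (cong (designEE 0 (addAbove h m 0 D) ++_)
                                 (trans (cong (λ x → designEE x (firstNewHub h c n ∷ secondNewHub h n ∷ []))
                                              (trans (length-addAbove h m 0 D) len))
                                        (designEE-newHubs n))))
                    (trans (handovers-∷ʳ 0 m) (cong (_++ [ ee m (suc m) ]) (handovers-∷ʳ 0 (h + c)))) ⟩
    (designEE 0 (addAbove h m 0 D) ++ Mb ++ M1a) ++ (H ++ [ ee (h + c) m ]) ++ [ ee m (suc m) ]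
      ↭⟨ ++⁺ʳ _ (++⁺ʳ (Mb ++ M1a) (designEE-addAbove h m 0 D)) ⟩
    ((designEE 0 D ++ map (λ j → ee j (partner h m j)) (range 0 (length D))) ++ Mb ++ M1a) ++
      (H ++ [ ee (h + c) m ]) ++ [ ee m (suc m) ]
      ≡⟨ cong (λ xs → ((designEE 0 D ++ xs) ++ Mb ++ M1a) ++ (H ++ [ ee (h + c) m ]) ++ [ ee m (suc m) ])
              (trans (cong (λ k → map (λ j → ee j (partner h m j)) (range 0 k)) len) partners-split) ⟩
    ((designEE 0 D ++ Ma ++ M1b) ++ Mb ++ M1a) ++ (H ++ [ ee (h + c) m ]) ++ [ ee m (suc m) ]
      ↭⟨ regroup (designEE 0 D) Ma M1b Mb M1a H [ ee (h + c) m ] [ ee m (suc m) ] ⟩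
    ((designEE 0 D ++ H) ++ Ma ++ Mb ++ [ ee (h + c) m ]) ++ M1a ++ M1b ++ [ ee m (suc m) ]
      ↭⟨ ++⁺ʳ _ (++⁺ʳ _ ee↭) ⟩
    (allEE m ++ Ma ++ Mb ++ [ ee (h + c) m ]) ++ M1a ++ M1b ++ [ ee m (suc m) ]
      ≡⟨ sym (cong₂ (λ xs ys → (allEE m ++ xs) ++ ys) eeTo-split eeToNext-split) ⟩
    allEE (suc (suc m)) ∎
    where
    open PermutationReasoning
    Ma = map (λ j → ee j m) (range 0 h)
    Mb = map (λ j → ee j m) (range h c)
    M1a = map (λ j → ee j (suc m)) (range 0 h)
    M1b = map (λ j → ee j (suc m)) (range h (suc c))
    H = handovers 0 m

rowPositions-below : ∀ q xs gs → rowPositions q (map below xs ++ gs) ≡ rowPositions (length xs + q) gs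
rowPositions-below q []       gs = refl
rowPositions-below q (x ∷ xs) gs = trans (rowPositions-below (suc q) xs gs) (cong (λ p → rowPositions p gs) (+-suc (length xs) q))

rowPositions-skips : ∀ q k → rowPositions q (replicate k skip) ≡ []
rowPositions-skips q zero    = refl
rowPositions-skips q (suc k) = rowPositions-skips (suc q) k

designRows-addAbove : ∀ h m i D → designRows (addAbove h m i D) ≡ designRows D
designRows-addAbove h m i []       = refl
designRows-addAbove h m i (gs ∷ D) =
  cong₂ _++_ (trans (rowPositions-∷ʳ gs _) (++-identityʳ _)) (designRows-addAbove h m (suc i) D)

designRows-newHubs : ∀ h c n → c ≤ n → designRows (firstNewHub h c (suc n) ∷ secondNewHub h (suc n) ∷ []) ≡ [ n ]
designRows-newHubs h c n c≤n = begin
  rowPositions 0 (map below (range h c) ++ replicate (n ∸ c) skip ++ [ row ]) ++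
    rowPositions 0 (map below (range 0 h) ++ replicate (suc n ∸ h) skip) ++ []
    ≡⟨ cong₂ (λ xs ys → xs ++ ys ++ []) (rowPositions-below 0 (range h c) _) (rowPositions-below 0 (range 0 h) _) ⟩
  rowPositions (length (range h c) + 0) (replicate (n ∸ c) skip ++ [ row ]) ++
    rowPositions (length (range 0 h) + 0) (replicate (suc n ∸ h) skip) ++ []
    ≡⟨ cong₂ (λ xs ys → xs ++ ys ++ []) (rowPositions-++ _ (replicate (n ∸ c) skip) [ row ]) (rowPositions-skips _ (suc n ∸ h)) ⟩
  (rowPositions (length (range h c) + 0) (replicate (n ∸ c) skip) ++
    [ length (replicate (n ∸ c) skip) + (length (range h c) + 0) ] ++ []) ++ []
    ≡⟨ cong₂ (λ xs k → (xs ++ [ k ]) ++ []) (rowPositions-skips _ (n ∸ c))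
             (cong₂ _+_ (length-replicate (n ∸ c)) (trans (+-identityʳ _) (length-range h c))) ⟩
  [ n ∸ c + c ]
    ≡⟨ cong [_] (m∸n+n≡m c≤n) ⟩
  [ n ] ∎
  where open ≡-Reasoning

addTwoHubs-admissible : ∀ h c n D → c < n → h ≤ n → Admissible (suc (h + c)) n D →
                        Admissible (suc (suc (suc (h + c)))) (suc n) (addTwoHubs h c n D)
addTwoHubs-admissible h c (suc n) D c<n h≤n (wf , len , ee↭ , rows↭) =
  wellFormed-addTwoHubs h c (suc n) D c<n h≤n wf len ,
  trans (length-++ (addAbove h m 0 D)) (trans (cong (_+ 2) (trans (length-addAbove h m 0 D) len)) (+-comm m 2)) ,
  addTwoHubs-EE h c (suc n) D len ee↭ ,
  ↭-trans (↭-reflexive (cong (0 ∷_) (trans (concatMap-++ (rowPositions 0) (addAbove h m 0 D) _)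
                                           (cong₂ _++_ (designRows-addAbove h m 0 D) (designRows-newHubs h c n (s≤s⁻¹ c<n))))))
          (↭-trans (++⁺ʳ [ n ] rows↭) (↭-reflexive (sym (range-∷ʳ 0 n))))
  where
  m = suc (h + c)

-- The new hubs need c < n and h ≤ n gaps: this is where m ≤ 2n is used.
hub-split : ∀ m n → suc m ≤ 2 * n → ∃₂ λ h c → h + c ≡ m × c < n × h ≤ n
hub-split m (suc n) 1+m≤2n with m ≤? n
... | yes m≤n = 0 , m , refl , s≤s m≤n , z≤n
... | no m≰n  = m ∸ n , n , m∸n+n≡m (<⇒≤ (≰⇒> m≰n)) , ≤-refl ,
                m≤n+o⇒m∸n≤o m n (subst (λ k → m ≤ n + k) (+-identityʳ (suc n)) (s≤s⁻¹ 1+m≤2n))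

admissible-base : ∀ m → 1 ≤ m → m ≤ 4 → Σ Design (Admissible m 2)
admissible-base 1 _ _ = ((skip ∷ []) ∷ []) , (((tt ∷ []) , refl) , tt) , refl , ↭-refl , ↭-refl
admissible-base 2 _ _ = ((skip ∷ []) ∷ (skip ∷ []) ∷ []) ,
  (((tt ∷ []) , refl) , ((tt ∷ []) , refl) , tt) , refl , ↭-refl , ↭-refl
admissible-base 3 _ _ = ((above 2 ∷ []) ∷ (skip ∷ []) ∷ (skip ∷ []) ∷ []) ,
  ((((λ ()) ∷ []) , refl) , ((tt ∷ []) , refl) , ((tt ∷ []) , refl) , tt) , refl , swap _ _ ↭-refl , ↭-refl
admissible-base 4 _ _ = ((above 2 ∷ []) ∷ (above 3 ∷ []) ∷ (skip ∷ []) ∷ (below 0 ∷ []) ∷ []) ,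
  ((((λ ()) ∷ []) , refl) , (((λ ()) ∷ []) , refl) , ((tt ∷ []) , refl) , (((λ ()) ∷ []) , refl) , tt) , refl ,
  solve 6 (λ a b c d e f → a ⊕ (b ⊕ (c ⊕ (d ⊕ (e ⊕ f)))) ⊜ d ⊕ (a ⊕ (e ⊕ (c ⊕ (b ⊕ f))))) ↭-refl
    [ ee 0 2 ] [ ee 1 3 ] [ ee 0 3 ] [ ee 0 1 ] [ ee 1 2 ] [ ee 2 3 ] , ↭-refl
admissible-base (suc (suc (suc (suc (suc _))))) _ (s≤s (s≤s (s≤s (s≤s ()))))

admissible : ∀ n m → 1 ≤ m → m ≤ 2 * suc (suc n) → Σ Design (Admissible m (suc (suc n)))
admissible zero    m 1≤m m≤4 = admissible-base m 1≤m m≤4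
admissible (suc n) m 1≤m m≤2n with m ≤? 2 * suc (suc n)
... | yes m≤ with admissible n m 1≤m m≤
...   | D , adm = lengthenPath D , lengthenPath-admissible m _ D 1≤m adm
admissible (suc n) 1 _ _ | no m≰ = ⊥-elim (m≰ (s≤s z≤n))
admissible (suc n) 2 _ _ | no m≰ = ⊥-elim (m≰ (s≤s (s≤s z≤n)))
admissible (suc n) (suc (suc (suc m))) _ m≤2n | no _ with hub-split m (suc (suc n)) m≤ | admissible n (suc m) (s≤s z≤n) m≤
  where
  m≤ : suc m ≤ 2 * suc (suc n)
  m≤ = s≤s⁻¹ (s≤s⁻¹ (subst (suc (suc (suc m)) ≤_) (*-suc 2 (suc (suc n))) m≤2n))
... | h , c , refl , c<n , h≤n | D , adm = addTwoHubs h c _ D , addTwoHubs-admissible h c _ D c<n h≤n adm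

record Cycle (R : Token → Token → Set) (m n : ℕ) : Set where
  constructor cycle
  field
    tokens      : List Token
    start       : Token
    closed      : Walk R start tokens start
    permutation : tokens ↭ allTokens m n

moveCycle : ∀ m n → 1 ≤ m → m ≤ 2 * suc (suc n) → Cycle Move m (suc (suc n))
moveCycle m n 1≤m m≤2n with admissible n m 1≤m m≤2n
... | [] , (_ , refl , _) = ⊥-elim (1+n≰n 1≤m)
... | gs ∷ D , adm@(wf , _) = cycle (tour 0 _ (gs ∷ D)) (pp 0 1) (tour-closed n gs D wf) (tour-↭-allTokens m _ gs D adm)

moveCycle-3-1 : Cycle Move 3 1
moveCycle-3-1 = cycle
  (ee 0 1 ∷ ep 1 0 ∷ ee 1 2 ∷ ep 2 0 ∷ ee 0 2 ∷ ep 0 0 ∷ []) (ep 0 0)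
  (ep⇒ee 0 0 1 (λ ()) ∷ ee˘⇒ep 1 0 0 (λ ()) ∷ ep⇒ee 1 0 2 (λ ()) ∷ ee˘⇒ep 2 0 1 (λ ()) ∷
   ep⇒ee˘ 2 0 0 (λ ()) ∷ ee⇒ep 0 0 2 (λ ()) ∷ [])
  (solve 6 (λ a b c d e f → d ⊕ (b ⊕ (e ⊕ (c ⊕ (f ⊕ a)))) ⊜ (a ⊕ (b ⊕ c)) ⊕ (d ⊕ (f ⊕ (e ⊕ id)))) ↭-refl
    [ ep 0 0 ] [ ep 1 0 ] [ ep 2 0 ] [ ee 0 1 ] [ ee 1 2 ] [ ee 0 2 ])

-- Tokens as 2-subsets

-- ⁅ x ⁆ for a natural-number index; empty when x ≥ N.
single : ∀ N → ℕ → Subset N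
single zero    _       = []
single (suc N) zero    = true ∷ ⊥
single (suc N) (suc x) = false ∷ single N x

lookup-single : ∀ N c (i : Fin N) → lookup (single N c) i ≡ (toℕ i ≡ᵇ c)
lookup-single (suc N) zero    Fin.zero    = refl
lookup-single (suc N) zero    (Fin.suc i) = lookup-replicate i false
lookup-single (suc N) (suc c) Fin.zero    = refl
lookup-single (suc N) (suc c) (Fin.suc i) = lookup-single N c i

single-toℕ : ∀ {N} (i : Fin N) → single N (toℕ i) ≡ ⁅ i ⁆
single-toℕ Fin.zero    = refl
single-toℕ (Fin.suc i) = cong (false ∷_) (single-toℕ i)

lookup-extensionality : ∀ {A : Set} {N} (u v : Vec A N) → (∀ i → lookup u i ≡ lookup v i) → u ≡ v
lookup-extensionality u v u≗v = trans (sym (tabulate∘lookup u)) (trans (tabulate-cong u≗v) (tabulate∘lookup v))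

≡ᵇ-true⇒≡ : ∀ x {y} → (x ≡ᵇ y) ≡ true → x ≡ y
≡ᵇ-true⇒≡ x {y} e = ≡ᵇ⇒≡ x y (subst T (sym e) tt)

exchange-Δ : ∀ N c a b → c ≢ a → c ≢ b → a ≢ b →
             (single N c ∪ single N a) Δ (single N c ∪ single N b) ≡ single N a ∪ single N b
exchange-Δ N c a b c≢a c≢b a≢b = lookup-extensionality _ _ pointwise
  where
  pointwise : ∀ i → lookup ((single N c ∪ single N a) Δ (single N c ∪ single N b)) i ≡ lookup (single N a ∪ single N b) i
  pointwise i rewrite lookup-zipWith _xor_ i (single N c ∪ single N a) (single N c ∪ single N b)
                    | lookup-zipWith _∨_ i (single N c) (single N a) | lookup-zipWith _∨_ i (single N c) (single N b)
                    | lookup-zipWith _∨_ i (single N a) (single N b)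
                    | lookup-single N c i | lookup-single N a i | lookup-single N b i
                    with toℕ i ≡ᵇ c in ec | toℕ i ≡ᵇ a in ea | toℕ i ≡ᵇ b in eb
  ... | true  | true  | _     = ⊥-elim (c≢a (trans (sym (≡ᵇ-true⇒≡ (toℕ i) ec)) (≡ᵇ-true⇒≡ (toℕ i) ea)))
  ... | true  | false | true  = ⊥-elim (c≢b (trans (sym (≡ᵇ-true⇒≡ (toℕ i) ec)) (≡ᵇ-true⇒≡ (toℕ i) eb)))
  ... | false | true  | true  = ⊥-elim (a≢b (trans (sym (≡ᵇ-true⇒≡ (toℕ i) ea)) (≡ᵇ-true⇒≡ (toℕ i) eb)))
  ... | true  | false | false = refl
  ... | false | true  | false = refl
  ... | false | false | true  = refl
  ... | false | false | false = refl

elements : ∀ {N} → Subset N → List ℕ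
elements []            = []
elements (true ∷ A)  = 0 ∷ map suc (elements A)
elements (false ∷ A) = map suc (elements A)

∣∣≡length-elements : ∀ {N} (A : Subset N) → ∣ A ∣ ≡ length (elements A)
∣∣≡length-elements []          = refl
∣∣≡length-elements (true ∷ A)  = cong suc (trans (∣∣≡length-elements A) (sym (length-map suc (elements A))))
∣∣≡length-elements (false ∷ A) = trans (∣∣≡length-elements A) (sym (length-map suc (elements A)))

elements-⊥ : ∀ N → elements (⊥ {N}) ≡ []
elements-⊥ zero    = refl
elements-⊥ (suc N) = cong (map suc) (elements-⊥ N)

∣A∣≡0⇒⊥ : ∀ {N} (A : Subset N) → ∣ A ∣ ≡ 0 → A ≡ ⊥
∣A∣≡0⇒⊥ []          _     = refl
∣A∣≡0⇒⊥ (false ∷ A) ∣A∣≡0 = cong (false ∷_) (∣A∣≡0⇒⊥ A ∣A∣≡0)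

elements-single : ∀ N b → b < N → elements (single N b) ≡ [ b ]
elements-single (suc N) zero    _       = cong (λ xs → 0 ∷ map suc xs) (elements-⊥ N)
elements-single (suc N) (suc b) (s≤s b<N) = cong (map suc) (elements-single N b b<N)

elements-pair : ∀ N a b → a < b → b < N → elements (single N a ∪ single N b) ≡ a ∷ b ∷ []
elements-pair (suc N) zero    (suc b) _         (s≤s b<N) =
  cong (λ xs → 0 ∷ map suc xs) (trans (cong elements (∪-identityˡ (single N b))) (elements-single N b b<N))
elements-pair (suc N) (suc a) (suc b) (s≤s a<b) (s≤s b<N) = cong (map suc) (elements-pair N a b a<b b<N)

∣pair∣≡2 : ∀ N a b → a < b → b < N → ∣ single N a ∪ single N b ∣ ≡ 2
∣pair∣≡2 N a b a<b b<N = trans (∣∣≡length-elements (single N a ∪ single N b)) (cong length (elements-pair N a b a<b b<N))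

∣A∣≡1⇒single : ∀ {N} (A : Subset N) → ∣ A ∣ ≡ 1 → ∃ λ b → b < N × A ≡ single N b
∣A∣≡1⇒single (true ∷ A)  ∣A∣≡1 = 0 , z<s , cong (true ∷_) (∣A∣≡0⇒⊥ A (suc-injective ∣A∣≡1))
∣A∣≡1⇒single (false ∷ A) ∣A∣≡1 with ∣A∣≡1⇒single A ∣A∣≡1
... | b , b<N , refl = suc b , s≤s b<N , refl

∣A∣≡2⇒pair : ∀ {N} (A : Subset N) → ∣ A ∣ ≡ 2 → ∃₂ λ a b → a < b × b < N × A ≡ single N a ∪ single N b
∣A∣≡2⇒pair (true ∷ A) ∣A∣≡2 with ∣A∣≡1⇒single A (suc-injective ∣A∣≡2)
... | b , b<N , refl = 0 , suc b , z<s , s≤s b<N , cong (true ∷_) (sym (∪-identityˡ (single _ b)))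
∣A∣≡2⇒pair (false ∷ A) ∣A∣≡2 with ∣A∣≡2⇒pair A ∣A∣≡2
... | a , b , a<b , b<N , refl = suc a , suc b , s≤s a<b , s≤s b<N , refl

module _ (m n : ℕ) where

  code : Vertex → ℕ
  code (E i) = i
  code (P j) = m + j

  ValidVertex : Vertex → Set
  ValidVertex (E i) = i < m
  ValidVertex (P j) = j < n

  encode : Token → Subset (m + n)
  encode t = single (m + n) (code (proj₁ (members t))) ∪ single (m + n) (code (proj₂ (members t)))

  classify : ℕ → ℕ → Token
  classify a b with b <? m | a <? m
  ... | yes _ | _     = ee a b
  ... | no _  | yes _ = ep a (b ∸ m)
  ... | no _  | no _  = pp (a ∸ m) (b ∸ m)

  -- The value on a subset that is not a pair is junk.
  decode : Subset (m + n) → Token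
  decode A with elements A
  ... | a ∷ b ∷ _ = classify a b
  ... | _         = ep 0 0

  codes-ordered : ∀ t → Valid m n t →
    code (proj₁ (members t)) < code (proj₂ (members t)) × code (proj₂ (members t)) < m + n
  codes-ordered (ee i j) (i<j , j<m) = i<j , ≤-trans j<m (m≤m+n m n)
  codes-ordered (ep i j) (i<m , j<n) = ≤-trans i<m (m≤m+n m j) , +-monoʳ-< m j<n
  codes-ordered (pp i j) (i<j , j<n) = +-monoʳ-< m i<j , +-monoʳ-< m j<n

  classify-codes : ∀ t → Valid m n t → classify (code (proj₁ (members t))) (code (proj₂ (members t))) ≡ t
  classify-codes (ee i j) (_ , j<m) with j <? m
  ... | yes _   = refl
  ... | no j≮m  = ⊥-elim (j≮m j<m)
  classify-codes (ep i j) (i<m , _) with m + j <? m | i <? m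
  ... | yes m+j<m | _       = ⊥-elim (<⇒≱ m+j<m (m≤m+n m j))
  ... | no _      | yes _   = cong (ep i) (m+n∸m≡n m j)
  ... | no _      | no i≮m  = ⊥-elim (i≮m i<m)
  classify-codes (pp i j) _ with m + j <? m | m + i <? m
  ... | yes m+j<m | _         = ⊥-elim (<⇒≱ m+j<m (m≤m+n m j))
  ... | no _      | yes m+i<m = ⊥-elim (<⇒≱ m+i<m (m≤m+n m i))
  ... | no _      | no _      = cong₂ pp (m+n∸m≡n m i) (m+n∸m≡n m j)

  decode-encode : ∀ t → Valid m n t → decode (encode t) ≡ t
  decode-encode t valid with codes-ordered t valid
  ... | a<b , b<N rewrite elements-pair (m + n) _ _ a<b b<N = classify-codes t valid

  ∣encode∣≡2 : ∀ t → Valid m n t → ∣ encode t ∣ ≡ 2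
  ∣encode∣≡2 t valid with codes-ordered t valid
  ... | a<b , b<N = ∣pair∣≡2 (m + n) _ _ a<b b<N

  classify-valid : ∀ a b → a < b → b < m + n →
    Valid m n (classify a b) × encode (classify a b) ≡ single (m + n) a ∪ single (m + n) b
  classify-valid a b a<b b<N with b <? m | a <? m
  ... | yes b<m | _       = (a<b , b<m) , refl
  ... | no b≮m  | yes a<m = (a<m , +-cancelˡ-< m _ _ (subst (_< m + n) (sym b≡) b<N)) ,
                            cong (λ x → single (m + n) a ∪ single (m + n) x) b≡
    where b≡ = m+[n∸m]≡n (≮⇒≥ b≮m)
  ... | no b≮m  | no a≮m  = (+-cancelˡ-< m _ _ (subst₂ _<_ (sym a≡) (sym b≡) a<b) ,
                             +-cancelˡ-< m _ _ (subst (_< m + n) (sym b≡) b<N)) ,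
                            cong₂ (λ x y → single (m + n) x ∪ single (m + n) y) a≡ b≡
    where
    a≡ = m+[n∸m]≡n (≮⇒≥ a≮m)
    b≡ = m+[n∸m]≡n (≮⇒≥ b≮m)

  decode-valid : ∀ A → ∣ A ∣ ≡ 2 → Valid m n (decode A) × encode (decode A) ≡ A
  decode-valid A ∣A∣≡2 with ∣A∣≡2⇒pair A ∣A∣≡2
  ... | a , b , a<b , b<N , refl rewrite elements-pair (m + n) a b a<b b<N = classify-valid a b a<b b<N

  vertex : ∀ t → Valid m n t → TokenVertex (Fan m n) 2
  vertex t valid = encode t , ∣encode∣≡2 t valid

  ∋-valid : ∀ {t c a} → t ∋ c , a → Valid m n t → ValidVertex c × ValidVertex a
  ∋-valid {ee i j} (inj₁ refl) (i<j , j<m) = <-trans i<j j<m , j<m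
  ∋-valid {ee i j} (inj₂ refl) (i<j , j<m) = j<m , <-trans i<j j<m
  ∋-valid {ep i j} (inj₁ refl) (i<m , j<n) = i<m , j<n
  ∋-valid {ep i j} (inj₂ refl) (i<m , j<n) = j<n , i<m
  ∋-valid {pp i j} (inj₁ refl) (i<j , j<n) = <-trans i<j j<n , j<n
  ∋-valid {pp i j} (inj₂ refl) (i<j , j<n) = j<n , <-trans i<j j<n

  encode-∋ : ∀ {t c a} → t ∋ c , a → encode t ≡ single (m + n) (code c) ∪ single (m + n) (code a)
  encode-∋ {t} (inj₁ e) = cong (λ (c , a) → single (m + n) (code c) ∪ single (m + n) (code a)) e
  encode-∋ {t} (inj₂ e) = trans (cong (λ (c , a) → single (m + n) (code c) ∪ single (m + n) (code a)) e) (∪-comm _ _)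

  code-bound : ∀ v → ValidVertex v → code v < m + n
  code-bound (E i) i<m = ≤-trans i<m (m≤m+n m n)
  code-bound (P j) j<n = +-monoʳ-< m j<n

  code-injective : ∀ u v → ValidVertex u → ValidVertex v → code u ≡ code v → u ≡ v
  code-injective (E i) (E j) _   _   e = cong E e
  code-injective (P i) (P j) _   _   e = cong P (+-cancelˡ-≡ m i j e)
  code-injective (E i) (P j) i<m _   e = ⊥-elim (<⇒≱ i<m (subst (m ≤_) (sym e) (m≤m+n m j)))
  code-injective (P i) (E j) _   j<m e = ⊥-elim (<⇒≱ j<m (subst (m ≤_) e (m≤m+n m i)))

  fin : ∀ v → ValidVertex v → Fin (m + n)
  fin v valid = fromℕ< (code-bound v valid)

  fin-E : ∀ i (i<m : i < m) → fin (E i) i<m ≡ fromℕ< i<m ↑ˡ n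
  fin-E i i<m = toℕ-injective (trans (toℕ-fromℕ< _) (sym (trans (toℕ-↑ˡ (fromℕ< i<m) n) (toℕ-fromℕ< i<m))))

  fin-P : ∀ j (j<n : j < n) → fin (P j) j<n ≡ m ↑ʳ fromℕ< j<n
  fin-P j j<n = toℕ-injective (trans (toℕ-fromℕ< _) (sym (trans (toℕ-↑ʳ m (fromℕ< j<n)) (cong (m +_) (toℕ-fromℕ< j<n)))))

  fanEdge⇒FanAdj : ∀ {u v} → FanEdge u v → (vu : ValidVertex u) (vv : ValidVertex v) → FanAdj m n (fin u vu) (fin v vv)
  fanEdge⇒FanAdj (spoke i j) vu vv = subst₂ (FanAdj m n) (sym (fin-E i vu)) (sym (fin-P j vv)) (join₁ _ _)
  fanEdge⇒FanAdj (spoke˘ i j) vu vv = subst₂ (FanAdj m n) (sym (fin-P j vu)) (sym (fin-E i vv)) (join₂ _ _)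
  fanEdge⇒FanAdj (rim j) vu vv = subst₂ (FanAdj m n) (sym (fin-P j vu)) (sym (fin-P (suc j) vv))
    (path₁ _ _ (trans (cong suc (toℕ-fromℕ< vu)) (sym (toℕ-fromℕ< vv))))
  fanEdge⇒FanAdj (rim˘ j) vu vv = subst₂ (FanAdj m n) (sym (fin-P (suc j) vu)) (sym (fin-P j vv))
    (path₂ _ _ (trans (cong suc (toℕ-fromℕ< vv)) (sym (toℕ-fromℕ< vu))))

  FanEdge⇒≢ : ∀ {u v} → FanEdge u v → u ≢ v
  FanEdge⇒≢ (rim j)  ()
  FanEdge⇒≢ (rim˘ j) ()

  single-fin : ∀ v (valid : ValidVertex v) → single (m + n) (code v) ≡ ⁅ fin v valid ⁆
  single-fin v valid = trans (cong (single (m + n)) (sym (toℕ-fromℕ< (code-bound v valid)))) (single-toℕ (fin v valid))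

  move⇒adjacent : ∀ {s t} → Move s t → (vs : Valid m n s) (vt : Valid m n t) →
                  TokenAdj (Fan m n) 2 (vertex s vs) (vertex t vt)
  move⇒adjacent {s} {t} (move {c} {a} {b} edge a≢c b≢c before after) vs vt =
    fin a va , fin b vb , (λ e → FanEdge⇒≢ edge (code-injective a b va vb (fin-code-injective e))) ,
    fanEdge⇒FanAdj edge va vb ,
    (begin
      encode s Δ encode t
        ≡⟨ cong₂ _Δ_ (encode-∋ before) (encode-∋ after) ⟩
      (single (m + n) (code c) ∪ single (m + n) (code a)) Δ (single (m + n) (code c) ∪ single (m + n) (code b))
        ≡⟨ exchange-Δ (m + n) (code c) (code a) (code b) (λ e → a≢c (sym (code-injective c a vc va e)))
                      (λ e → b≢c (sym (code-injective c b vc vb e))) (λ e → FanEdge⇒≢ edge (code-injective a b va vb e)) ⟩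
      single (m + n) (code a) ∪ single (m + n) (code b)
        ≡⟨ cong₂ _∪_ (single-fin a va) (single-fin b vb) ⟩
      ⁅ fin a va ⁆ ∪ ⁅ fin b vb ⁆ ∎)
    where
    open ≡-Reasoning
    vc = proj₁ (∋-valid before vs)
    va = proj₂ (∋-valid before vs)
    vb = proj₂ (∋-valid after vt)
    fin-code-injective : fin a va ≡ fin b vb → code a ≡ code b
    fin-code-injective e = trans (sym (toℕ-fromℕ< (code-bound a va))) (trans (cong toℕ e) (toℕ-fromℕ< (code-bound b vb)))

vertex-≡ : ∀ {N} {A B : Subset N} {p : ∣ A ∣ ≡ 2} {q : ∣ B ∣ ≡ 2} → A ≡ B →
           _≡_ {A = Σ (Subset N) λ X → ∣ X ∣ ≡ 2} (A , p) (B , q)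
vertex-≡ {p = p} {q} refl = cong (_ ,_) (≡-irrelevant p q)

moveCycle⇒hamiltonian : ∀ m n → Cycle Move m n → 3 ≤ length (allTokens m n) → TokenHamiltonian (Fan m n) 2
moveCycle⇒hamiltonian m n (cycle [] _ _ L↭) 3≤ = ⊥-elim (<⇒≱ 3≤ (subst (_≤ 2) (↭-length L↭) z≤n))
moveCycle⇒hamiltonian m n (cycle L@(_ ∷ _) _ closed L↭) 3≤ =
  length L , subst (3 ≤_) (sym (↭-length L↭)) 3≤ , f , (f-injective , f-surjective) , f-adjacent
  where
  unique : Unique L
  unique = Unique-resp-↭ (setoid Token) (↭⇒↭ₛ (↭-sym L↭)) (allTokens-unique m n)
  valid : ∀ {t} → t ∈ L → Valid m n t
  valid t∈ = ∈-allTokens⁻ m n (∈-resp-↭ L↭ t∈)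
  f : Fin (length L) → TokenVertex (Fan m n) 2
  f i = vertex m n (List.lookup L i) (valid (∈-lookup i))
  f-injective : ∀ {i j} → f i ≡ f j → i ≡ j
  f-injective {i} {j} e = Unique-lookup-injective unique i j
    (trans (sym (decode-encode m n _ (valid (∈-lookup i))))
           (trans (cong (decode m n ∘ proj₁) e) (decode-encode m n _ (valid (∈-lookup j)))))
  f-surjective : ∀ X → ∃ λ i → ∀ {j} → j ≡ i → f j ≡ X
  f-surjective (A , ∣A∣≡2) =
    Any.index t∈ , λ { refl → vertex-≡ (trans (cong (encode m n) (sym (lookup-index t∈))) (proj₂ decoded)) }
    where
    decoded = decode-valid m n A ∣A∣≡2
    t∈ : decode m n A ∈ L
    t∈ = ∈-resp-↭ (↭-sym L↭) (∈-allTokens⁺ m n _ (proj₁ decoded))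
  f-adjacent : ∀ i → TokenAdj (Fan m n) 2 (f i) (f (next i))
  f-adjacent i with next-cases i
  ... | inj₁ e = move⇒adjacent m n (walk-step closed i (next i) e) (valid (∈-lookup i)) (valid (∈-lookup (next i)))
  ... | inj₂ (e₀ , e-last) = subst (λ j → TokenAdj (Fan m n) 2 (f i) (f j)) (sym e₀)
          (subst (λ t → (vt : Valid m n t) → TokenAdj (Fan m n) 2 (vertex m n t vt) (f Fin.zero))
                 (sym (walk-last closed i e-last))
                 (λ vt → move⇒adjacent m n (walk-first closed Fin.zero refl) vt (valid (∈-lookup {xs = L} Fin.zero)))
                 (valid (∈-lookup i)))

-- Necessity

data Kind : Set where
  EE EP PP : Kind

kind : Token → Kind
kind (ee _ _) = EE
kind (ep _ _) = EP
kind (pp _ _) = PP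

-- The constraints on consecutive vertices of a Hamiltonian cycle of F_{m,n}^{2}.
Compatible : ℕ → Kind → Kind → Set
Compatible n EE k = k ≡ EP
Compatible n EP k = n ≡ 1 → k ≡ EE
Compatible n PP k = k ≢ EE

Follows : ℕ → Token → Token → Set
Follows n x y = Compatible n (kind x) (kind y)

-- Exchanging codes: {a₁, a₂} Δ {b₁, b₂} = {u, v}, where codes below m are hubs.
module _ (m n : ℕ) {a₁ a₂ b₁ b₂ u v : ℕ} (a₁<a₂ : a₁ < a₂) (a₂<N : a₂ < m + n) (b₁<b₂ : b₁ < b₂) (b₂<N : b₂ < m + n)
         (Δ≡ : ∀ x → x < m + n → does (x ∈?⟨ a₁ , a₂ ⟩) xor does (x ∈?⟨ b₁ , b₂ ⟩) ≡ does (x ∈?⟨ u , v ⟩)) where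

  private
    a₁<N = <-trans a₁<a₂ a₂<N
    b₁<N = <-trans b₁<b₂ b₂<N

    first-in-S : ¬ a₁ ∈⟨ b₁ , b₂ ⟩ → a₁ ∈⟨ u , v ⟩
    first-in-S = xor-onlyˡ (a₁ ∈?⟨ a₁ , a₂ ⟩) (a₁ ∈?⟨ b₁ , b₂ ⟩) (a₁ ∈?⟨ u , v ⟩) (Δ≡ a₁ a₁<N) (inj₁ refl)

    second-in-S : ¬ a₂ ∈⟨ b₁ , b₂ ⟩ → a₂ ∈⟨ u , v ⟩
    second-in-S = xor-onlyˡ (a₂ ∈?⟨ a₁ , a₂ ⟩) (a₂ ∈?⟨ b₁ , b₂ ⟩) (a₂ ∈?⟨ u , v ⟩) (Δ≡ a₂ a₂<N) (inj₂ refl)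

    S⊆A : ¬ a₁ ∈⟨ b₁ , b₂ ⟩ → ¬ a₂ ∈⟨ b₁ , b₂ ⟩ → ∀ {w} → w ∈⟨ u , v ⟩ → w ∈⟨ a₁ , a₂ ⟩
    S⊆A a₁∉B a₂∉B = exhaust (first-in-S a₁∉B) (second-in-S a₂∉B) (<⇒≢ a₁<a₂)

    below-all : ∀ {x c d} → x < c → c < d → ¬ x ∈⟨ c , d ⟩
    below-all x<c c<d (inj₁ refl) = <-irrefl refl x<c
    below-all x<c c<d (inj₂ refl) = <-irrefl refl (<-trans x<c c<d)

    above-all : ∀ {x c d} → d < x → c < d → ¬ x ∈⟨ c , d ⟩
    above-all d<x c<d (inj₁ refl) = <-irrefl refl (<-trans d<x c<d)
    above-all d<x c<d (inj₂ refl) = <-irrefl refl d<x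

  after-ee : a₂ < m → ∀ {w} → w ∈⟨ u , v ⟩ → m ≤ w → w < m + n → b₁ < m × m ≤ b₂
  after-ee a₂<m {w} w∈S m≤w w<N = b₁<m , m≤b₂
    where
    w∉A : ¬ w ∈⟨ a₁ , a₂ ⟩
    w∉A = above-all (<-≤-trans a₂<m m≤w) a₁<a₂
    m≤b₂ : m ≤ b₂
    m≤b₂ with xor-moved (w ∈?⟨ a₁ , a₂ ⟩) (w ∈?⟨ b₁ , b₂ ⟩) (w ∈?⟨ u , v ⟩) (Δ≡ w w<N) w∈S w∉A
    ... | inj₁ refl = ≤-trans m≤w (<⇒≤ b₁<b₂)
    ... | inj₂ refl = m≤w
    b₁<m : b₁ < m
    b₁<m with b₁ <? m
    ... | yes b₁<m = b₁<m
    ... | no b₁≮m  = ⊥-elim (w∉A (S⊆A (below-all (<-≤-trans (<-trans a₁<a₂ a₂<m) (≮⇒≥ b₁≮m)) b₁<b₂)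
                                      (below-all (<-≤-trans a₂<m (≮⇒≥ b₁≮m)) b₁<b₂) w∈S))

  after-pp : m ≤ a₁ → ¬ b₂ < m
  after-pp m≤a₁ b₂<m =
    b₁∉A (S⊆A (above-all (<-≤-trans b₂<m m≤a₁) b₁<b₂) (above-all (<-≤-trans b₂<m (≤-trans m≤a₁ (<⇒≤ a₁<a₂))) b₁<b₂)
              (xor-onlyʳ (b₁ ∈?⟨ a₁ , a₂ ⟩) (b₁ ∈?⟨ b₁ , b₂ ⟩) (b₁ ∈?⟨ u , v ⟩) (Δ≡ b₁ b₁<N) b₁∉A (inj₁ refl)))
    where
    b₁∉A : ¬ b₁ ∈⟨ a₁ , a₂ ⟩
    b₁∉A = below-all (<-≤-trans (<-trans b₁<b₂ b₂<m) m≤a₁) a₁<a₂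

  after-ep : n ≡ 1 → m ∈⟨ u , v ⟩ → m ≤ a₂ → b₂ < m
  after-ep refl m∈S m≤a₂ with b₂ <? m
  ... | yes b₂<m = b₂<m
  ... | no b₂≮m  = ⊥-elim (xor-both (m ∈?⟨ a₁ , a₂ ⟩) (m ∈?⟨ b₁ , b₂ ⟩) (m ∈?⟨ u , v ⟩) (Δ≡ m m<N)
                                    (inj₂ (sym (top a₂<N m≤a₂))) (inj₂ (sym (top b₂<N (≮⇒≥ b₂≮m)))) m∈S)
    where
    m<N : m < m + 1
    m<N = m<m+n m z<s
    top : ∀ {x} → x < m + 1 → m ≤ x → x ≡ m
    top {x} x< m≤x = ≤-antisym (s≤s⁻¹ (subst (x <_) (+-comm m 1) x<)) m≤x

module _ (m n : ℕ) where

  data CodeKind (a b : ℕ) : Kind → Set where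
    ee-codes : b < m → CodeKind a b EE
    ep-codes : a < m → m ≤ b → CodeKind a b EP
    pp-codes : m ≤ a → CodeKind a b PP

  codeKind : ∀ a b → CodeKind a b (kind (classify m n a b))
  codeKind a b with b <? m | a <? m
  ... | yes b<m | _       = ee-codes b<m
  ... | no b≮m  | yes a<m = ep-codes a<m (≮⇒≥ b≮m)
  ... | no _    | no a≮m  = pp-codes (≮⇒≥ a≮m)

  m≤path : ∀ (j : Fin n) → m ≤ toℕ (m ↑ʳ j)
  m≤path j = subst (m ≤_) (sym (toℕ-↑ʳ m j)) (m≤m+n m (toℕ j))

  path-endpoint : ∀ {u v} → FanAdj m n u v → ∃ λ w → w ∈⟨ toℕ u , toℕ v ⟩ × m ≤ w × w < m + n
  path-endpoint {u} {v} (join₁ i j)   = toℕ v , inj₂ refl , m≤path j , toℕ<n v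
  path-endpoint {u} {v} (join₂ i j)   = toℕ u , inj₁ refl , m≤path j , toℕ<n u
  path-endpoint {u} {v} (path₁ i j _) = toℕ u , inj₁ refl , m≤path i , toℕ<n u
  path-endpoint {u} {v} (path₂ i j _) = toℕ u , inj₁ refl , m≤path i , toℕ<n u

  p₀ : (j : Fin 1) → toℕ (m ↑ʳ j) ≡ m
  p₀ Fin.zero = trans (toℕ-↑ʳ m Fin.zero) (+-identityʳ m)

  touches-p₀ : n ≡ 1 → ∀ {u v} → FanAdj m n u v → m ∈⟨ toℕ u , toℕ v ⟩
  touches-p₀ refl (join₁ i j)   = inj₂ (sym (p₀ j))
  touches-p₀ refl (join₂ i j)   = inj₁ (sym (p₀ j))
  touches-p₀ refl (path₁ i j e) = ⊥-elim (1+n≢0 (trans e (n<1⇒n≡0 (toℕ<n j))))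
  touches-p₀ refl (path₂ i j e) = ⊥-elim (1+n≢0 (trans e (n<1⇒n≡0 (toℕ<n i))))

  pair-lookup : ∀ a b x (x<N : x < m + n) → lookup (single (m + n) a ∪ single (m + n) b) (fromℕ< x<N) ≡ does (x ∈?⟨ a , b ⟩)
  pair-lookup a b x x<N =
    trans (lookup-zipWith _∨_ (fromℕ< x<N) (single (m + n) a) (single (m + n) b))
          (cong₂ _∨_ (trans (lookup-single (m + n) a (fromℕ< x<N)) (cong (_≡ᵇ a) (toℕ-fromℕ< x<N)))
                     (trans (lookup-single (m + n) b (fromℕ< x<N)) (cong (_≡ᵇ b) (toℕ-fromℕ< x<N))))

  Δ-pointwise : ∀ {a₁ a₂ b₁ b₂} (u v : Fin (m + n)) →
    (single (m + n) a₁ ∪ single (m + n) a₂) Δ (single (m + n) b₁ ∪ single (m + n) b₂) ≡ ⁅ u ⁆ ∪ ⁅ v ⁆ →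
    ∀ x → x < m + n → does (x ∈?⟨ a₁ , a₂ ⟩) xor does (x ∈?⟨ b₁ , b₂ ⟩) ≡ does (x ∈?⟨ toℕ u , toℕ v ⟩)
  Δ-pointwise {a₁} {a₂} {b₁} {b₂} u v Δ≡ x x<N = begin
    does (x ∈?⟨ a₁ , a₂ ⟩) xor does (x ∈?⟨ b₁ , b₂ ⟩)
      ≡⟨ sym (cong₂ _xor_ (pair-lookup a₁ a₂ x x<N) (pair-lookup b₁ b₂ x x<N)) ⟩
    lookup A (fromℕ< x<N) xor lookup B (fromℕ< x<N)
      ≡⟨ sym (lookup-zipWith _xor_ (fromℕ< x<N) A B) ⟩
    lookup (A Δ B) (fromℕ< x<N)
      ≡⟨ cong (λ S → lookup S (fromℕ< x<N)) (trans Δ≡ (sym (cong₂ _∪_ (single-toℕ u) (single-toℕ v)))) ⟩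
    lookup (single (m + n) (toℕ u) ∪ single (m + n) (toℕ v)) (fromℕ< x<N)
      ≡⟨ pair-lookup (toℕ u) (toℕ v) x x<N ⟩
    does (x ∈?⟨ toℕ u , toℕ v ⟩) ∎
    where
    open ≡-Reasoning
    A = single (m + n) a₁ ∪ single (m + n) a₂
    B = single (m + n) b₁ ∪ single (m + n) b₂

  module _ {a₁ a₂ b₁ b₂} (a₁<a₂ : a₁ < a₂) (a₂<N : a₂ < m + n) (b₁<b₂ : b₁ < b₂) (b₂<N : b₂ < m + n)
           {u v : Fin (m + n)} (edge : FanAdj m n u v)
           (Δ≡ : (single (m + n) a₁ ∪ single (m + n) a₂) Δ (single (m + n) b₁ ∪ single (m + n) b₂) ≡ ⁅ u ⁆ ∪ ⁅ v ⁆) where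

    private
      ee-next : a₂ < m → b₁ < m × m ≤ b₂
      ee-next a₂<m with path-endpoint edge
      ... | w , w∈ , m≤w , w<N = after-ee m n a₁<a₂ a₂<N b₁<b₂ b₂<N (Δ-pointwise u v Δ≡) a₂<m w∈ m≤w w<N

      ep-next : n ≡ 1 → m ≤ a₂ → b₂ < m
      ep-next n≡1 = after-ep m n a₁<a₂ a₂<N b₁<b₂ b₂<N (Δ-pointwise u v Δ≡) n≡1 (touches-p₀ n≡1 edge)

      pp-next : m ≤ a₁ → ¬ b₂ < m
      pp-next = after-pp m n a₁<a₂ a₂<N b₁<b₂ b₂<N (Δ-pointwise u v Δ≡)

    exchanged-pairs-compatible : Compatible n (kind (classify m n a₁ a₂)) (kind (classify m n b₁ b₂))
    exchanged-pairs-compatible with kind (classify m n a₁ a₂) | codeKind a₁ a₂ | kind (classify m n b₁ b₂) | codeKind b₁ b₂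
    ... | EE | ee-codes a₂<m   | EE | ee-codes b₂<m   = ⊥-elim (<⇒≱ b₂<m (proj₂ (ee-next a₂<m)))
    ... | EE | ee-codes _      | EP | ep-codes _ _    = refl
    ... | EE | ee-codes a₂<m   | PP | pp-codes m≤b₁   = ⊥-elim (<⇒≱ (proj₁ (ee-next a₂<m)) m≤b₁)
    ... | EP | ep-codes _ _    | EE | ee-codes _      = λ _ → refl
    ... | EP | ep-codes _ m≤a₂ | EP | ep-codes _ m≤b₂ = λ n≡1 → ⊥-elim (<⇒≱ (ep-next n≡1 m≤a₂) m≤b₂)
    ... | EP | ep-codes _ m≤a₂ | PP | pp-codes m≤b₁   = λ n≡1 → ⊥-elim (<⇒≱ (ep-next n≡1 m≤a₂) (≤-trans m≤b₁ (<⇒≤ b₁<b₂)))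
    ... | PP | pp-codes m≤a₁   | EE | ee-codes b₂<m   = λ _ → pp-next m≤a₁ b₂<m
    ... | PP | pp-codes _      | EP | ep-codes _ _    = λ ()
    ... | PP | pp-codes _      | PP | pp-codes _      = λ ()

  adjacent⇒follows : ∀ X Y → TokenAdj (Fan m n) 2 X Y → Follows n (decode m n (proj₁ X)) (decode m n (proj₁ Y))
  adjacent⇒follows (A , ∣A∣≡2) (B , ∣B∣≡2) (u , v , _ , edge , Δ≡) with ∣A∣≡2⇒pair A ∣A∣≡2 | ∣A∣≡2⇒pair B ∣B∣≡2
  ... | a₁ , a₂ , a₁<a₂ , a₂<N , refl | b₁ , b₂ , b₁<b₂ , b₂<N , refl
    rewrite elements-pair (m + n) a₁ a₂ a₁<a₂ a₂<N | elements-pair (m + n) b₁ b₂ b₁<b₂ b₂<N =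
    exchanged-pairs-compatible a₁<a₂ a₂<N b₁<b₂ b₂<N edge Δ≡

hamiltonian⇒cycle : ∀ m n → TokenHamiltonian (Fan m n) 2 → Cycle (Follows n) m n
hamiltonian⇒cycle m n (suc k , _ , f , (f-injective , f-surjective) , adjacent) =
  cycle (List.tabulate g) (g (Fin.fromℕ k)) (cyclic-walk k g (λ i → adjacent⇒follows m n (f i) (f (next i)) (adjacent i)))
        (same-elements-↭ (Unique.tabulate⁺ g-injective) (allTokens-unique m n) g-valid g-complete)
  where
  g : Fin (suc k) → Token
  g i = decode m n (proj₁ (f i))
  decoded : ∀ i → Valid m n (g i) × encode m n (g i) ≡ proj₁ (f i)
  decoded i = decode-valid m n (proj₁ (f i)) (proj₂ (f i))
  g-injective : ∀ {i j} → g i ≡ g j → i ≡ j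
  g-injective {i} {j} e =
    f-injective (vertex-≡ (trans (sym (proj₂ (decoded i))) (trans (cong (encode m n) e) (proj₂ (decoded j)))))
  g-valid : ∀ {t} → t ∈ List.tabulate g → t ∈ allTokens m n
  g-valid t∈ with ∈-tabulate⁻ {f = g} t∈
  ... | i , refl = ∈-allTokens⁺ m n (g i) (proj₁ (decoded i))
  g-complete : ∀ {t} → t ∈ allTokens m n → t ∈ List.tabulate g
  g-complete {t} t∈ with f-surjective (vertex m n t (∈-allTokens⁻ m n t∈))
  ... | i , f≡ = subst (_∈ List.tabulate g)
                       (trans (cong (decode m n ∘ proj₁) (f≡ refl)) (decode-encode m n t (∈-allTokens⁻ m n t∈)))
                      (∈-tabulate⁺ {f = g} i)

total : (Kind → ℕ) → List Kind → ℕ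
total h ks = sum (map h ks)

indicator : Kind → Kind → ℕ
indicator EE EE = 1
indicator EP EP = 1
indicator PP PP = 1
indicator _  _  = 0

exit : Kind → Kind → ℕ
exit PP EE = 1
exit PP EP = 1
exit _  _  = 0

stepSum : (Kind → Kind → ℕ) → Kind → List Kind → ℕ
stepSum w a []       = 0
stepSum w a (k ∷ ks) = w a k + stepSum w k ks

module _ {R : Kind → Kind → Set} where

  stepSum-≤ : ∀ (w : Kind → Kind → ℕ) h → (∀ {x y} → R x y → w x y ≤ h y) → ∀ {a ks b} → Walk R a ks b →
              stepSum w a ks ≤ total h ks
  stepSum-≤ w h w≤h []      = z≤n
  stepSum-≤ w h w≤h (r ∷ p) = +-mono-≤ (w≤h r) (stepSum-≤ w h w≤h p)

  stepSum-sources : ∀ h {a ks b} → Walk R a ks b → stepSum (λ x _ → h x) a ks + h b ≡ h a + total h ks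
  stepSum-sources h {a} []                = +-comm 0 (h a)
  stepSum-sources h {a} (_∷_ {b = k} {xs = ks} {c = b} _ p) =
    trans (+-assoc (h a) (stepSum (λ x _ → h x) k ks) (h b)) (cong (h a +_) (stepSum-sources h p))

  closed-stepSum : ∀ h {a ks} → Walk R a ks a → stepSum (λ x _ → h x) a ks ≡ total h ks
  closed-stepSum h {a} {ks} p =
    +-cancelʳ-≡ (h a) _ _ (trans (stepSum-sources h p) (+-comm (h a) (total h ks)))

  exits-from-PP : ∀ {ks b} → Walk R PP ks b → ∀ {k} → k ∈ ks → k ≢ PP → 1 ≤ stepSum exit PP ks
  exits-from-PP (_∷_ {b = EE} _ _) _           _    = s≤s z≤n
  exits-from-PP (_∷_ {b = EP} _ _) _           _    = s≤s z≤n
  exits-from-PP (_∷_ {b = PP} _ p) (here refl) k≢PP = ⊥-elim (k≢PP refl)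
  exits-from-PP (_∷_ {b = PP} _ p) (there k∈) k≢PP  = exits-from-PP p k∈ k≢PP

  walk-end-∈ : ∀ {a ks b} → Walk R a ks b → b ≡ a ⊎ b ∈ ks
  walk-end-∈ []      = inj₁ refl
  walk-end-∈ (_ ∷ p) = inj₂ ([ (λ { refl → here refl }) , there ]′ (walk-end-∈ p))

  exits-to-end : ∀ {a ks b} → Walk R a ks b → b ≢ PP → PP ∈ ks → 1 ≤ stepSum exit a ks
  exits-to-end {a} (_∷_ {b = PP} _ p) b≢PP (here refl) with walk-end-∈ p
  ... | inj₁ refl = ⊥-elim (b≢PP refl)
  ... | inj₂ b∈   = ≤-trans (exits-from-PP p b∈ b≢PP) (m≤n+m _ (exit a PP))
  exits-to-end {a} (_∷_ {b = k} _ p) b≢PP (there PP∈) = ≤-trans (exits-to-end p b≢PP PP∈) (m≤n+m _ (exit a k))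

compatible-EE : ∀ {n k k′} → Compatible n k k′ → indicator EE k + exit k k′ ≤ indicator EP k′
compatible-EE {k = EE} {EP} _    = ≤-refl
compatible-EE {k = EP}          _ = z≤n
compatible-EE {k = PP} {EE} EE≢EE = ⊥-elim (EE≢EE refl)
compatible-EE {k = PP} {EP} _    = ≤-refl
compatible-EE {k = PP} {PP} _    = z≤n

compatible-EP : ∀ {n k k′} → n ≡ 1 → Compatible n k k′ → indicator EP k ≤ indicator EE k′
compatible-EP {k = EE}          _   _       = z≤n
compatible-EP {k = EP}          n≡1 follows with follows n≡1
... | refl = ≤-refl
compatible-EP {k = PP}          _   _       = z≤n

total-++ : ∀ h ks ks′ → total h (ks ++ ks′) ≡ total h ks + total h ks′
total-++ h ks ks′ = trans (cong sum (map-++ h ks ks′)) (sum-++ (map h ks) (map h ks′))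

total-replicate : ∀ h l k → total h (replicate l k) ≡ l * h k
total-replicate h zero    k = refl
total-replicate h (suc l) k = cong (h k +_) (total-replicate h l k)

map-kind-const : ∀ {k xs} → All (λ t → kind t ≡ k) xs → map kind xs ≡ replicate (length xs) k
map-kind-const []          = refl
map-kind-const (px ∷ pxs) = cong₂ _∷_ px (map-kind-const pxs)

kinds-allTokens : ∀ m n → map kind (allTokens m n) ≡
  replicate (length (epTokens 0 m n)) EP ++ replicate (length (allEE m)) EE ++ replicate (length (allPP n)) PP
kinds-allTokens m n =
  trans (map-++ kind (epTokens 0 m n) _)
        (cong₂ _++_ (map-kind-const (All.tabulate λ t∈ → kind-ep (∈-epTokens⁻ 0 m n t∈)))
                    (trans (map-++ kind (allEE m) _)
                           (cong₂ _++_ (map-kind-const (All.tabulate λ t∈ → kind-ee (∈-allEE⁻ m t∈)))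
                                       (map-kind-const (All.tabulate λ t∈ → kind-pp (∈-ppRows⁻ n 0 (n ∸ 1) t∈))))))
  where
  kind-ep : ∀ {t} → (∃₂ λ i j → t ≡ ep i j × _) → kind t ≡ EP
  kind-ep (_ , _ , refl , _) = refl
  kind-ee : ∀ {t} → (∃₂ λ i j → t ≡ ee i j × _) → kind t ≡ EE
  kind-ee (_ , _ , refl , _) = refl
  kind-pp : ∀ {t} → (∃₂ λ i j → t ≡ pp i j × _) → kind t ≡ PP
  kind-pp (_ , _ , refl , _) = refl

count-allTokens : ∀ m n k → total (indicator k) (map kind (allTokens m n)) ≡
  m * n * indicator k EP + (length (allEE m) * indicator k EE + length (allPP n) * indicator k PP)
count-allTokens m n k = begin
  total h (map kind (allTokens m n))
    ≡⟨ cong (total h) (kinds-allTokens m n) ⟩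
  total h (replicate #EP EP ++ replicate #EE EE ++ replicate #PP PP)
    ≡⟨ trans (total-++ h (replicate #EP EP) _) (cong (total h (replicate #EP EP) +_) (total-++ h (replicate #EE EE) _)) ⟩
  total h (replicate #EP EP) + (total h (replicate #EE EE) + total h (replicate #PP PP))
    ≡⟨ cong₂ _+_ (trans (total-replicate h #EP EP) (cong (_* h EP) (length-epTokens 0 m n)))
                 (cong₂ _+_ (total-replicate h #EE EE) (total-replicate h #PP PP)) ⟩
  m * n * h EP + (#EE * h EE + #PP * h PP) ∎
  where
  open ≡-Reasoning
  h = indicator k
  #EP = length (epTokens 0 m n)
  #EE = length (allEE m)
  #PP = length (allPP n)

stepSum-+ : ∀ w₁ w₂ a ks → stepSum (λ x y → w₁ x y + w₂ x y) a ks ≡ stepSum w₁ a ks + stepSum w₂ a ks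
stepSum-+ w₁ w₂ a []       = refl
stepSum-+ w₁ w₂ a (k ∷ ks) =
  trans (cong (w₁ a k + w₂ a k +_) (stepSum-+ w₁ w₂ k ks)) (+-interchange (w₁ a k) (w₂ a k) _ _)
  where
  +-interchange : ∀ a b c d → (a + b) + (c + d) ≡ (a + c) + (b + d)
  +-interchange = solve-∀

module _ {n : ℕ} where

  closed-walk-EE : ∀ {a ks} → Walk (Compatible n) a ks a →
                   total (indicator EE) ks + stepSum exit a ks ≤ total (indicator EP) ks
  closed-walk-EE {a} {ks} w = begin
    total (indicator EE) ks + stepSum exit a ks
      ≡⟨ cong (_+ stepSum exit a ks) (sym (closed-stepSum (indicator EE) w)) ⟩
    stepSum (λ x _ → indicator EE x) a ks + stepSum exit a ks
      ≡⟨ sym (stepSum-+ (λ x _ → indicator EE x) exit a ks) ⟩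
    stepSum (λ x y → indicator EE x + exit x y) a ks
      ≤⟨ stepSum-≤ _ (indicator EP) compatible-EE w ⟩
    total (indicator EP) ks ∎
    where open ≤-Reasoning

  closed-walk-EP : ∀ {a ks} → n ≡ 1 → Walk (Compatible n) a ks a → total (indicator EP) ks ≤ total (indicator EE) ks
  closed-walk-EP n≡1 w =
    subst (_≤ _) (closed-stepSum (indicator EP) w)
          (stepSum-≤ (λ x _ → indicator EP x) (indicator EE) (compatible-EP n≡1) w)

triangle-bound : ∀ m n L → 2 * L + m ≡ m * m → L < m * n → m ≤ 2 * n
triangle-bound m n L 2L+m≡m² L<mn with m ≤? 2 * n
... | yes m≤2n = m≤2n
... | no m≰2n  = ⊥-elim (<⇒≱ L<mn
    (*-cancelˡ-≤ 2 (+-cancelʳ-≤ m _ _ (subst₂ _≤_ (expand m n) (sym 2L+m≡m²) (*-monoʳ-≤ m (≰⇒> m≰2n))))))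
  where
  expand : ∀ m n → m * suc (2 * n) ≡ 2 * (m * n) + m
  expand = solve-∀

triangle-fixed : ∀ m L → 1 ≤ m → 2 * L + m ≡ m * m → L ≡ m → m ≡ 3
triangle-fixed (suc m) L _ 2L+m≡m² refl =
  sym (*-cancelˡ-≡ 3 (suc m) (suc m) (trans (*-comm (suc m) 3) (trans (+-comm (suc m) (2 * suc m)) 2L+m≡m²)))

module _ {m n : ℕ} (c : Cycle (Follows n) m n) where
  open Cycle c

  private
    kinds = map kind tokens

    closed-kinds : Walk (Compatible n) (kind start) kinds (kind start)
    closed-kinds = walk-map kind (λ follows → follows) closed

    count-kinds : ∀ k → total (indicator k) kinds ≡
      m * n * indicator k EP + (length (allEE m) * indicator k EE + length (allPP n) * indicator k PP)
    count-kinds k = trans (sum-↭ (↭-map⁺ (indicator k) (↭-map⁺ kind permutation))) (count-allTokens m n k)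

    #EE : total (indicator EE) kinds ≡ length (allEE m)
    #EE = trans (count-kinds EE) (only-middle (m * n) (length (allEE m)) (length (allPP n)))
      where
      only-middle : ∀ a b c → a * 0 + (b * 1 + c * 0) ≡ b
      only-middle = solve-∀

    #EP : total (indicator EP) kinds ≡ m * n
    #EP = trans (count-kinds EP) (only-first (m * n) (length (allEE m)) (length (allPP n)))
      where
      only-first : ∀ a b c → a * 1 + (b * 0 + c * 0) ≡ a
      only-first = solve-∀

    ∈-kinds : ∀ t → Valid m n t → kind t ∈ kinds
    ∈-kinds t valid = ∈-map⁺ kind (∈-resp-↭ (↭-sym permutation) (∈-allTokens⁺ m n t valid))

  exitsFromPP : ℕ
  exitsFromPP = stepSum exit (kind start) kinds

  cycle-EE-bound : length (allEE m) + exitsFromPP ≤ m * n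
  cycle-EE-bound = subst₂ (λ a b → a + exitsFromPP ≤ b) #EE #EP (closed-walk-EE closed-kinds)

  cycle-EP-bound : n ≡ 1 → m * n ≤ length (allEE m)
  cycle-EP-bound n≡1 = subst₂ _≤_ #EP #EE (closed-walk-EP n≡1 closed-kinds)

  cycle-exits-PP : 1 ≤ m → 2 ≤ n → 1 ≤ exitsFromPP
  cycle-exits-PP 1≤m 2≤n with kind start | closed-kinds
  ... | PP | w = exits-from-PP w (∈-kinds (ep 0 0) (1≤m , <-trans z<s 2≤n)) (λ ())
  ... | EE | w = exits-to-end w (λ ()) (∈-kinds (pp 0 1) (z<s , 2≤n))
  ... | EP | w = exits-to-end w (λ ()) (∈-kinds (pp 0 1) (z<s , 2≤n))

cycle⇒m≡3 : ∀ {m} → 1 ≤ m → Cycle (Follows 1) m 1 → m ≡ 3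
cycle⇒m≡3 {m} 1≤m c = triangle-fixed m (length (allEE m)) 1≤m (length-allEE m)
  (≤-antisym (≤-trans (m≤m+n _ _) (subst (length (allEE m) + exitsFromPP c ≤_) (*-identityʳ m) (cycle-EE-bound c)))
             (subst (_≤ length (allEE m)) (*-identityʳ m) (cycle-EP-bound c refl)))

cycle⇒m≤2n : ∀ {m n} → 1 ≤ m → 2 ≤ n → Cycle (Follows n) m n → m ≤ 2 * n
cycle⇒m≤2n {m} {n} 1≤m 2≤n c = triangle-bound m n (length (allEE m)) (length-allEE m)
  (≤-trans (subst (_≤ length (allEE m) + exitsFromPP c) (+-comm (length (allEE m)) 1)
                  (+-monoʳ-≤ (length (allEE m)) (cycle-exits-PP c 1≤m 2≤n)))
           (cycle-EE-bound c))

follows-cycle⇒bounds : ∀ m n → 1 ≤ m → 1 ≤ n → Cycle (Follows n) m n → (2 ≤ n × 1 ≤ m × m ≤ 2 * n) ⊎ (n ≡ 1 × m ≡ 3)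
follows-cycle⇒bounds m n 1≤m 1≤n c with n ≟ 1
... | yes refl = inj₂ (refl , cycle⇒m≡3 1≤m c)
... | no n≢1   = inj₁ (2≤n , 1≤m , cycle⇒m≤2n 1≤m 2≤n c)
  where
  2≤n : 2 ≤ n
  2≤n = ≤∧≢⇒< 1≤n (λ e → n≢1 (sym e))

three≤length-allTokens : ∀ {m n} → 1 ≤ m → 2 ≤ n → 3 ≤ length (allTokens m n)
three≤length-allTokens {m} {n} 1≤m 2≤n = begin
  2 + 1
    ≤⟨ +-mono-≤ (subst (2 ≤_) (sym (length-epTokens 0 m n)) (*-mono-≤ 1≤m 2≤n))
               (≤-trans (∈-length (∈-allPP⁺ n 0 1 z<s 2≤n)) (m≤n+m _ (length (allEE m)))) ⟩
  length (epTokens 0 m n) + (length (allEE m) + length (allPP n))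
    ≡⟨ sym (trans (length-++ (epTokens 0 m n)) (cong (length (epTokens 0 m n) +_) (length-++ (allEE m)))) ⟩
  length (allTokens m n) ∎
  where open ≤-Reasoning

theorem1 : (m n : ℕ) → 1 ≤ m → 1 ≤ n →
    TokenHamiltonian (Fan m n) 2 ⇔ ((2 ≤ n × 1 ≤ m × m ≤ 2 * n) ⊎ (n ≡ 1 × m ≡ 3))
theorem1 m n 1≤m 1≤n = mk⇔ (follows-cycle⇒bounds m n 1≤m 1≤n ∘ hamiltonian⇒cycle m n) sufficient
  where
  sufficient : (2 ≤ n × 1 ≤ m × m ≤ 2 * n) ⊎ (n ≡ 1 × m ≡ 3) → TokenHamiltonian (Fan m n) 2
  sufficient (inj₁ (2≤n@(s≤s (s≤s _)) , _ , m≤2n)) =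
    moveCycle⇒hamiltonian m n (moveCycle m _ 1≤m m≤2n) (three≤length-allTokens 1≤m 2≤n)
  sufficient (inj₂ (refl , refl)) = moveCycle⇒hamiltonian 3 1 moveCycle-3-1 (s≤s (s≤s (s≤s z≤n)))
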